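{- The categories $\mathbf{CCCs}$ and $\mathbf{Scwf}^{\mathrm{N}_1,\times,\Rightarrow}_{\mathrm{ctx}}$ are equivalent.
   Context: A cartesian category with structure is a category with a chosen terminal object and chosen binary products $(A\times B,\mathrm{fst}_{A,B},\mathrm{snd}_{A,B})$. A cartesian closed category with structure additionally has, for all objects $A,B$, a chosen object $A\Rightarrow B$ and evaluation $\varepsilon_{A,B} : (A\Rightarrow B)\times A\to B$ such that for every $f : C\times A\to B$ there is a unique $h : C\to A\Rightarrow B$ with $\varepsilon_{A,B}\circ(h\times A) = f$. $\mathbf{CCCs}$ is the category of small such categories and functors preserving all this chosen structure on the nose (terminal object, products and projections, $F(A\Rightarrow B) = FA\Rightarrow FB$, $F(\varepsilon_{A,B}) = \varepsilon_{FA,FB}$). A simply typed cwf (scwf) consists of a category $\mathcal{C}$ with chosen terminal object $1$; a set $\mathrm{Ty}$; presheaves $\mathrm{Tm}(-,A)$ on $\mathcal{C}$ for $A\in\mathrm{Ty}$ (action $a[\gamma]$); and chosen $\Gamma\cdot A$, $\mathrm{p}_{\Gamma,A}:\Gamma\cdot A\to\Gamma$, $\mathrm{q}_{\Gamma,A}\in\mathrm{Tm}(\Gamma\cdot A,A)$ such that for all $\gamma:\Delta\to\Gamma$, $a\in\mathrm{Tm}(\Delta,A)$ there is a unique $\langle\gamma,a\rangle:\Delta\to\Gamma\cdot A$ with $\mathrm{p}\circ\langle\gamma,a\rangle=\gamma$, $\mathrm{q}[\langle\gamma,a\rangle]=a$. A strict scwf-morphism is a functor preserving $1$, a map on types and natural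 maps on terms $\mathrm{Tm}(\Gamma,A)\to\mathrm{Tm}(F\Gamma,FA)$, with $F(\Gamma\cdot A)=F\Gamma\cdot FA$, $F(\mathrm{p})=\mathrm{p}$, $F(\mathrm{q})=\mathrm{q}$. Contextual: there is $l:\mathcal{C}_0\to\mathbb{N}$ with $l(\Gamma)=0$ iff $\Gamma=1$, and $l(\Gamma)=n+1$ iff $\Gamma=\Delta\cdot A$ for unique $\Delta,A$, with $l(\Delta)=n$. $\mathrm{N}_1$-structure: a type $\mathrm{N}_1$ and for each $\Gamma$ a term $0_1\in\mathrm{Tm}(\Gamma,\mathrm{N}_1)$ equal to every element of $\mathrm{Tm}(\Gamma,\mathrm{N}_1)$. $\times$-structure: types $A\times B$ and operations $\mathrm{fst},\mathrm{snd},\langle-,-\rangle$ on terms in each context with $\mathrm{fst}\langle a,b\rangle=a$, $\mathrm{snd}\langle a,b\rangle=b$, $\langle\mathrm{fst}(c),\mathrm{snd}(c)\rangle=c$, $\langle a,b\rangle[\gamma]=\langle a[\gamma],b[\gamma]\rangle$. $\Rightarrow$-structure: types $A\Rightarrow B$ and operations $\lambda_{\Gamma,A,B}:\mathrm{Tm}(\Gamma\cdot A,B)\to\mathrm{Tm}(\Gamma,A\Rightarrow B)$, $\mathrm{ap}_{\Gamma,A,B}:\mathrm{Tm}(\Gamma,A\Rightarrow B)\times\mathrm{Tm}(\Gamma,A)\to\mathrm{Tm}(\Gamma,B)$ with, for $\gamma:\Delta\to\Gamma$: $\lambda(b)[\gamma]=\lambda(b[\langle\gamma\circ\mathrm{p}_{\Delta,A},\mathrm{q}_{\Delta,A}\rangle])$,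 $\mathrm{ap}(c,a)[\gamma]=\mathrm{ap}(c[\gamma],a[\gamma])$, $\mathrm{ap}(\lambda(b),a)=b[\langle\mathrm{id}_\Gamma,a\rangle]$, $\lambda(\mathrm{ap}(c[\mathrm{p}_{\Gamma,A}],\mathrm{q}_{\Gamma,A}))=c$. A strict morphism preserves these if $F(\mathrm{N}_1)=\mathrm{N}_1$, $F(0_1)=0_1$, $F(A\times B)=FA\times FB$, $F(\mathrm{fst}(c))=\mathrm{fst}(Fc)$, $F(\mathrm{snd}(c))=\mathrm{snd}(Fc)$, $F(A\Rightarrow B)=FA\Rightarrow FB$, $F(\mathrm{ap}(c,a))=\mathrm{ap}(Fc,Fa)$. $\mathbf{Scwf}^{\mathrm{N}_1,\times,\Rightarrow}_{\mathrm{ctx}}$ is the category of small contextual scwfs with $\mathrm{N}_1$-, $\times$- and $\Rightarrow$-structure and strict morphisms preserving this structure on the nose. -}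

module Defs where

open import Data.Nat using (ℕ; zero; suc)
open import Data.Product using (Σ; _,_)
open import Relation.Binary.PropositionalEquality
  using (_≡_; refl; sym; trans; cong; subst; subst₂)

subst-subst : ∀ {A : Set} (P : A → Set) {x y z : A}
  (e₁ : x ≡ y) (e₂ : y ≡ z) (u : P x) →
  subst P e₂ (subst P e₁ u) ≡ subst P (trans e₁ e₂) u
subst-subst P refl refl u = refl

subst-map : ∀ {A B : Set} (P : A → Set) (Q : B → Set) (f : A → B)
  (g : ∀ {x} → P x → Q (f x)) {x y : A} (e : x ≡ y) (u : P x) →
  subst Q (cong f e) (g u) ≡ g (subst P e u)
subst-map P Q f g refl u = refl

record CCC : Set₁ where
  infixr 9 _∘_
  infixr 7 _×_
  infixr 6 _⇒_
  field
    Obj : Set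
    Hom : Obj → Obj → Set
    id  : ∀ {A} → Hom A A
    _∘_ : ∀ {A B C} → Hom B C → Hom A B → Hom A C
    identityˡ : ∀ {A B} (f : Hom A B) → id ∘ f ≡ f
    identityʳ : ∀ {A B} (f : Hom A B) → f ∘ id ≡ f
    assoc : ∀ {A B C D} (h : Hom C D) (g : Hom B C) (f : Hom A B) →
            (h ∘ g) ∘ f ≡ h ∘ (g ∘ f)
    ⊤ : Obj
    ! : ∀ {A} → Hom A ⊤
    !-unique : ∀ {A} (f : Hom A ⊤) → f ≡ !
    _×_ : Obj → Obj → Obj
    fst : ∀ {A B} → Hom (A × B) A
    snd : ∀ {A B} → Hom (A × B) B
    ⟨_,_⟩ : ∀ {C A B} → Hom C A → Hom C B → Hom C (A × B)
    fst-β : ∀ {C A B} (f : Hom C A) (g : Hom C B) → fst ∘ ⟨ f , g ⟩ ≡ f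
    snd-β : ∀ {C A B} (f : Hom C A) (g : Hom C B) → snd ∘ ⟨ f , g ⟩ ≡ g
    ⟨⟩-unique : ∀ {C A B} {f : Hom C A} {g : Hom C B} (h : Hom C (A × B)) →
                fst ∘ h ≡ f → snd ∘ h ≡ g → h ≡ ⟨ f , g ⟩
    _⇒_ : Obj → Obj → Obj
    eval : ∀ {A B} → Hom ((A ⇒ B) × A) B
    curry : ∀ {C A B} → Hom (C × A) B → Hom C (A ⇒ B)
    -- h × A  is  ⟨ h ∘ fst , snd ⟩
    eval-β : ∀ {C A B} (f : Hom (C × A) B) →
             eval ∘ ⟨ curry f ∘ fst , snd ⟩ ≡ f
    curry-unique : ∀ {C A B} {f : Hom (C × A) B} (h : Hom C (A ⇒ B)) →
                   eval ∘ ⟨ h ∘ fst , snd ⟩ ≡ f → h ≡ curry f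

record CCCMor (C D : CCC) : Set where
  private
    module C = CCC C
    module D = CCC D
  field
    F₀ : C.Obj → D.Obj
    F₁ : ∀ {A B} → C.Hom A B → D.Hom (F₀ A) (F₀ B)
    F-id : ∀ {A} → F₁ (C.id {A}) ≡ D.id
    F-∘ : ∀ {A B E} (g : C.Hom B E) (f : C.Hom A B) →
          F₁ (g C.∘ f) ≡ F₁ g D.∘ F₁ f
    F-⊤ : F₀ C.⊤ ≡ D.⊤
    F-× : ∀ A B → F₀ (A C.× B) ≡ F₀ A D.× F₀ B
    F-fst : ∀ A B →
      subst (λ X → D.Hom X (F₀ A)) (F-× A B) (F₁ (C.fst {A} {B})) ≡ D.fst
    F-snd : ∀ A B →
      subst (λ X → D.Hom X (F₀ B)) (F-× A B) (F₁ (C.snd {A} {B})) ≡ D.snd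
    F-⇒ : ∀ A B → F₀ (A C.⇒ B) ≡ F₀ A D.⇒ F₀ B
    F-eval : ∀ A B →
      subst (λ X → D.Hom X (F₀ B))
            (trans (F-× (A C.⇒ B) A) (cong (λ Y → Y D.× F₀ A) (F-⇒ A B)))
            (F₁ (C.eval {A} {B}))
      ≡ D.eval

record CScwf : Set₁ where
  infixr 9 _∘_
  infixl 8 _[_]
  infixl 5 _▹_
  infixr 7 _×ᵗ_
  infixr 6 _⇒ᵗ_
  field
    -- category of contexts and substitutions (Sub Δ Γ = morphisms Δ → Γ)
    Ctx : Set
    Sub : Ctx → Ctx → Set
    id  : ∀ {Γ} → Sub Γ Γ
    _∘_ : ∀ {Γ Δ Θ} → Sub Δ Θ → Sub Γ Δ → Sub Γ Θ
    identityˡ : ∀ {Γ Δ} (f : Sub Γ Δ) → id ∘ f ≡ f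
    identityʳ : ∀ {Γ Δ} (f : Sub Γ Δ) → f ∘ id ≡ f
    assoc : ∀ {Γ Δ Θ Ξ} (h : Sub Θ Ξ) (g : Sub Δ Θ) (f : Sub Γ Δ) →
            (h ∘ g) ∘ f ≡ h ∘ (g ∘ f)
    ◇ : Ctx
    ! : ∀ {Γ} → Sub Γ ◇
    !-unique : ∀ {Γ} (f : Sub Γ ◇) → f ≡ !
    Ty : Set
    Tm : Ctx → Ty → Set
    _[_] : ∀ {Γ Δ A} → Tm Γ A → Sub Δ Γ → Tm Δ A
    [id] : ∀ {Γ A} (a : Tm Γ A) → a [ id ] ≡ a
    [∘] : ∀ {Γ Δ Θ A} (a : Tm Γ A) (γ : Sub Δ Γ) (δ : Sub Θ Δ) →
          a [ γ ∘ δ ] ≡ a [ γ ] [ δ ]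
    _▹_ : Ctx → Ty → Ctx
    p : ∀ {Γ A} → Sub (Γ ▹ A) Γ
    q : ∀ {Γ A} → Tm (Γ ▹ A) A
    ⟨_,_⟩ : ∀ {Γ Δ A} → Sub Δ Γ → Tm Δ A → Sub Δ (Γ ▹ A)
    p∘⟨⟩ : ∀ {Γ Δ A} (γ : Sub Δ Γ) (a : Tm Δ A) → p ∘ ⟨ γ , a ⟩ ≡ γ
    q[⟨⟩] : ∀ {Γ Δ A} (γ : Sub Δ Γ) (a : Tm Δ A) → q [ ⟨ γ , a ⟩ ] ≡ a
    ⟨⟩-unique : ∀ {Γ Δ A} {γ : Sub Δ Γ} {a : Tm Δ A} (h : Sub Δ (Γ ▹ A)) →
                p ∘ h ≡ γ → q [ h ] ≡ a → h ≡ ⟨ γ , a ⟩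
    -- contextuality (a length function l with the stated properties)
    len : Ctx → ℕ
    len-◇ : len ◇ ≡ zero
    len-zero : ∀ {Γ} → len Γ ≡ zero → Γ ≡ ◇
    len-▹ : ∀ Δ A → len (Δ ▹ A) ≡ suc (len Δ)
    len-suc : ∀ {Γ n} → len Γ ≡ suc n →
              Σ Ctx λ Δ → Σ Ty λ A → Σ (Γ ≡ Δ ▹ A) λ _ → len Δ ≡ n
    ▹-inj-ctx : ∀ {Δ Δ' A A'} → Δ ▹ A ≡ Δ' ▹ A' → Δ ≡ Δ'
    ▹-inj-ty  : ∀ {Δ Δ' A A'} → Δ ▹ A ≡ Δ' ▹ A' → A ≡ A'
    N₁ : Ty
    0₁ : ∀ {Γ} → Tm Γ N₁
    N₁-η : ∀ {Γ} (t : Tm Γ N₁) → t ≡ 0₁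
    _×ᵗ_ : Ty → Ty → Ty
    fst : ∀ {Γ A B} → Tm Γ (A ×ᵗ B) → Tm Γ A
    snd : ∀ {Γ A B} → Tm Γ (A ×ᵗ B) → Tm Γ B
    pair : ∀ {Γ A B} → Tm Γ A → Tm Γ B → Tm Γ (A ×ᵗ B)
    fst-β : ∀ {Γ A B} (a : Tm Γ A) (b : Tm Γ B) → fst (pair a b) ≡ a
    snd-β : ∀ {Γ A B} (a : Tm Γ A) (b : Tm Γ B) → snd (pair a b) ≡ b
    pair-η : ∀ {Γ A B} (c : Tm Γ (A ×ᵗ B)) → pair (fst c) (snd c) ≡ c
    pair-[] : ∀ {Γ Δ A B} (a : Tm Γ A) (b : Tm Γ B) (γ : Sub Δ Γ) →
              pair a b [ γ ] ≡ pair (a [ γ ]) (b [ γ ])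
    _⇒ᵗ_ : Ty → Ty → Ty
    lam : ∀ {Γ A B} → Tm (Γ ▹ A) B → Tm Γ (A ⇒ᵗ B)
    ap : ∀ {Γ A B} → Tm Γ (A ⇒ᵗ B) → Tm Γ A → Tm Γ B
    lam-[] : ∀ {Γ Δ A B} (b : Tm (Γ ▹ A) B) (γ : Sub Δ Γ) →
             lam b [ γ ] ≡ lam (b [ ⟨ γ ∘ p {Δ} {A} , q ⟩ ])
    ap-[] : ∀ {Γ Δ A B} (c : Tm Γ (A ⇒ᵗ B)) (a : Tm Γ A) (γ : Sub Δ Γ) →
            ap c a [ γ ] ≡ ap (c [ γ ]) (a [ γ ])
    ⇒-β : ∀ {Γ A B} (b : Tm (Γ ▹ A) B) (a : Tm Γ A) →
          ap (lam b) a ≡ b [ ⟨ id , a ⟩ ]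
    ⇒-η : ∀ {Γ A B} (c : Tm Γ (A ⇒ᵗ B)) →
          lam (ap (c [ p {Γ} {A} ]) q) ≡ c

record ScwfMor (S T : CScwf) : Set where
  private
    module S = CScwf S
    module T = CScwf T
  field
    F₀ : S.Ctx → T.Ctx
    F₁ : ∀ {Δ Γ} → S.Sub Δ Γ → T.Sub (F₀ Δ) (F₀ Γ)
    F-id : ∀ {Γ} → F₁ (S.id {Γ}) ≡ T.id
    F-∘ : ∀ {Γ Δ Θ} (g : S.Sub Δ Θ) (f : S.Sub Γ Δ) →
          F₁ (g S.∘ f) ≡ F₁ g T.∘ F₁ f
    F-◇ : F₀ S.◇ ≡ T.◇
    FTy : S.Ty → T.Ty
    FTm : ∀ {Γ A} → S.Tm Γ A → T.Tm (F₀ Γ) (FTy A)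
    FTm-[] : ∀ {Γ Δ A} (a : S.Tm Γ A) (γ : S.Sub Δ Γ) →
             FTm (a S.[ γ ]) ≡ FTm a T.[ F₁ γ ]
    F-▹ : ∀ Γ A → F₀ (Γ S.▹ A) ≡ F₀ Γ T.▹ FTy A
    F-p : ∀ Γ A →
      subst (λ X → T.Sub X (F₀ Γ)) (F-▹ Γ A) (F₁ (S.p {Γ} {A})) ≡ T.p
    F-q : ∀ Γ A →
      subst (λ X → T.Tm X (FTy A)) (F-▹ Γ A) (FTm (S.q {Γ} {A})) ≡ T.q
    F-N₁ : FTy S.N₁ ≡ T.N₁
    F-0₁ : ∀ Γ → subst (T.Tm (F₀ Γ)) F-N₁ (FTm (S.0₁ {Γ})) ≡ T.0₁
    F-×ᵗ : ∀ A B → FTy (A S.×ᵗ B) ≡ FTy A T.×ᵗ FTy B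
    F-fst : ∀ {Γ A B} (c : S.Tm Γ (A S.×ᵗ B)) →
      FTm (S.fst c) ≡ T.fst (subst (T.Tm (F₀ Γ)) (F-×ᵗ A B) (FTm c))
    F-snd : ∀ {Γ A B} (c : S.Tm Γ (A S.×ᵗ B)) →
      FTm (S.snd c) ≡ T.snd (subst (T.Tm (F₀ Γ)) (F-×ᵗ A B) (FTm c))
    F-⇒ᵗ : ∀ A B → FTy (A S.⇒ᵗ B) ≡ FTy A T.⇒ᵗ FTy B
    F-ap : ∀ {Γ A B} (c : S.Tm Γ (A S.⇒ᵗ B)) (a : S.Tm Γ A) →
      FTm (S.ap c a) ≡ T.ap (subst (T.Tm (F₀ Γ)) (F-⇒ᵗ A B) (FTm c)) (FTm a)

record MetaCat : Set₂ where
  infixr 9 _∘_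
  infix 4 _≈_
  field
    Obj : Set₁
    Hom : Obj → Obj → Set
    _≈_ : ∀ {A B} → Hom A B → Hom A B → Set
    id  : ∀ {A} → Hom A A
    _∘_ : ∀ {A B C} → Hom B C → Hom A B → Hom A C
    ≈-refl : ∀ {A B} (f : Hom A B) → f ≈ f
    identityˡ : ∀ {A B} (f : Hom A B) → id ∘ f ≈ f
    identityʳ : ∀ {A B} (f : Hom A B) → f ∘ id ≈ f
    assoc : ∀ {A B C D} (h : Hom C D) (g : Hom B C) (f : Hom A B) →
            (h ∘ g) ∘ f ≈ h ∘ (g ∘ f)

record MetaFunctor (C D : MetaCat) : Set₁ where
  private
    module C = MetaCat C
    module D = MetaCat D
  field
    F₀ : C.Obj → D.Obj
    F₁ : ∀ {A B} → C.Hom A B → D.Hom (F₀ A) (F₀ B)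
    F-resp-≈ : ∀ {A B} {f g : C.Hom A B} → f C.≈ g → F₁ f D.≈ F₁ g
    F-id : ∀ {A} → F₁ (C.id {A}) D.≈ D.id
    F-∘ : ∀ {A B E} (g : C.Hom B E) (f : C.Hom A B) →
          F₁ (g C.∘ f) D.≈ F₁ g D.∘ F₁ f

record Equivalence (C D : MetaCat) : Set₁ where
  private
    module C = MetaCat C
    module D = MetaCat D
  field
    F : MetaFunctor C D
    G : MetaFunctor D C
  private
    module F = MetaFunctor F
    module G = MetaFunctor G
  field
    η : ∀ X → C.Hom X (G.F₀ (F.F₀ X))
    η⁻¹ : ∀ X → C.Hom (G.F₀ (F.F₀ X)) X
    η-isoˡ : ∀ X → η⁻¹ X C.∘ η X C.≈ C.id
    η-isoʳ : ∀ X → η X C.∘ η⁻¹ X C.≈ C.id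
    η-natural : ∀ {X Y} (h : C.Hom X Y) →
                G.F₁ (F.F₁ h) C.∘ η X C.≈ η Y C.∘ h
    ε : ∀ Y → D.Hom (F.F₀ (G.F₀ Y)) Y
    ε⁻¹ : ∀ Y → D.Hom Y (F.F₀ (G.F₀ Y))
    ε-isoˡ : ∀ Y → ε⁻¹ Y D.∘ ε Y D.≈ D.id
    ε-isoʳ : ∀ Y → ε Y D.∘ ε⁻¹ Y D.≈ D.id
    ε-natural : ∀ {X Y} (h : D.Hom X Y) →
                h D.∘ ε X D.≈ ε Y D.∘ F.F₁ (G.F₁ h)

_≈ᶜ_ : ∀ {C D} → CCCMor C D → CCCMor C D → Set
_≈ᶜ_ {C} {D} F G =
  Σ (∀ A → F.F₀ A ≡ G.F₀ A) λ e →
    ∀ {A B} (f : CCC.Hom C A B) → subst₂ (CCC.Hom D) (e A) (e B) (F.F₁ f) ≡ G.F₁ f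
  where
    module F = CCCMor F
    module G = CCCMor G

idᶜ : ∀ {C} → CCCMor C C
idᶜ {C} = record
  { F₀ = λ A → A ; F₁ = λ f → f ; F-id = refl ; F-∘ = λ _ _ → refl
  ; F-⊤ = refl ; F-× = λ _ _ → refl ; F-fst = λ _ _ → refl
  ; F-snd = λ _ _ → refl ; F-⇒ = λ _ _ → refl ; F-eval = λ _ _ → refl }

_∘ᶜ_ : ∀ {C D E} → CCCMor D E → CCCMor C D → CCCMor C E
_∘ᶜ_ {C} {D} {E} G F = record
  { F₀ = λ A → G.F₀ (F.F₀ A)
  ; F₁ = λ f → G.F₁ (F.F₁ f)
  ; F-id = trans (cong G.F₁ F.F-id) G.F-id
  ; F-∘ = λ g f → trans (cong G.F₁ (F.F-∘ g f)) (G.F-∘ (F.F₁ g) (F.F₁ f))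
  ; F-⊤ = trans (cong G.F₀ F.F-⊤) G.F-⊤
  ; F-× = H×
  ; F-fst = λ A B →
      trans (sym (subst-subst (λ X → E.Hom X (G.F₀ (F.F₀ A)))
                   (cong G.F₀ (F.F-× A B)) (G.F-× (F.F₀ A) (F.F₀ B)) _))
     (trans (cong (subst (λ X → E.Hom X (G.F₀ (F.F₀ A))) (G.F-× (F.F₀ A) (F.F₀ B)))
              (subst-map (λ X → D.Hom X (F.F₀ A)) (λ Y → E.Hom Y (G.F₀ (F.F₀ A)))
                 G.F₀ G.F₁ (F.F-× A B) (F.F₁ C.fst)))
     (trans (cong (λ u → subst (λ X → E.Hom X (G.F₀ (F.F₀ A))) (G.F-× (F.F₀ A) (F.F₀ B)) (G.F₁ u))
              (F.F-fst A B))
            (G.F-fst (F.F₀ A) (F.F₀ B))))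
  ; F-snd = λ A B →
      trans (sym (subst-subst (λ X → E.Hom X (G.F₀ (F.F₀ B)))
                   (cong G.F₀ (F.F-× A B)) (G.F-× (F.F₀ A) (F.F₀ B)) _))
     (trans (cong (subst (λ X → E.Hom X (G.F₀ (F.F₀ B))) (G.F-× (F.F₀ A) (F.F₀ B)))
              (subst-map (λ X → D.Hom X (F.F₀ B)) (λ Y → E.Hom Y (G.F₀ (F.F₀ B)))
                 G.F₀ G.F₁ (F.F-× A B) (F.F₁ C.snd)))
     (trans (cong (λ u → subst (λ X → E.Hom X (G.F₀ (F.F₀ B))) (G.F-× (F.F₀ A) (F.F₀ B)) (G.F₁ u))
              (F.F-snd A B))
            (G.F-snd (F.F₀ A) (F.F₀ B))))
  ; F-⇒ = H⇒
  ; F-eval = Heval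
  }
  where
    module C = CCC C
    module D = CCC D
    module E = CCC E
    module F = CCCMor F
    module G = CCCMor G
    H× : ∀ A B → G.F₀ (F.F₀ (A C.× B)) ≡ G.F₀ (F.F₀ A) E.× G.F₀ (F.F₀ B)
    H× A B = trans (cong G.F₀ (F.F-× A B)) (G.F-× (F.F₀ A) (F.F₀ B))
    H⇒ : ∀ A B → G.F₀ (F.F₀ (A C.⇒ B)) ≡ G.F₀ (F.F₀ A) E.⇒ G.F₀ (F.F₀ B)
    H⇒ A B = trans (cong G.F₀ (F.F-⇒ A B)) (G.F-⇒ (F.F₀ A) (F.F₀ B))
    evalLemma : ∀ (A' B' : D.Obj) {S X X' : D.Obj} {Z' : E.Obj}
      (a : S ≡ X D.× A') (c : X ≡ X') (d : G.F₀ X' ≡ Z') (u : D.Hom S B') →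
      subst (λ W → E.Hom W (G.F₀ B'))
        (trans (trans (cong G.F₀ a) (G.F-× X A'))
               (cong (λ Y → Y E.× G.F₀ A') (trans (cong G.F₀ c) d)))
        (G.F₁ u)
      ≡ subst (λ W → E.Hom W (G.F₀ B'))
          (trans (G.F-× X' A') (cong (λ Y → Y E.× G.F₀ A') d))
          (G.F₁ (subst (λ W → D.Hom W B') (trans a (cong (λ Y → Y D.× A') c)) u))
    evalLemma A' B' refl refl refl u = refl
    Heval : ∀ A B →
      subst (λ X → E.Hom X (G.F₀ (F.F₀ B)))
        (trans (H× (A C.⇒ B) A) (cong (λ Y → Y E.× G.F₀ (F.F₀ A)) (H⇒ A B)))
        (G.F₁ (F.F₁ (C.eval {A} {B})))
      ≡ E.eval
    Heval A B =
      trans (evalLemma (F.F₀ A) (F.F₀ B) (F.F-× (A C.⇒ B) A) (F.F-⇒ A B)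
               (G.F-⇒ (F.F₀ A) (F.F₀ B)) (F.F₁ C.eval))
     (trans (cong (λ u → subst (λ X → E.Hom X (G.F₀ (F.F₀ B)))
                    (trans (G.F-× (F.F₀ A D.⇒ F.F₀ B) (F.F₀ A))
                           (cong (λ Y → Y E.× G.F₀ (F.F₀ A)) (G.F-⇒ (F.F₀ A) (F.F₀ B))))
                    (G.F₁ u))
              (F.F-eval A B))
            (G.F-eval (F.F₀ A) (F.F₀ B)))

CCCs : MetaCat
CCCs = record
  { Obj = CCC ; Hom = CCCMor ; _≈_ = _≈ᶜ_ ; id = idᶜ ; _∘_ = _∘ᶜ_
  ; ≈-refl = λ _ → ((λ _ → refl) , (λ _ → refl))
  ; identityˡ = λ _ → ((λ _ → refl) , (λ _ → refl))
  ; identityʳ = λ _ → ((λ _ → refl) , (λ _ → refl))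
  ; assoc = λ _ _ _ → ((λ _ → refl) , (λ _ → refl)) }

_≈ˢ_ : ∀ {S T} → ScwfMor S T → ScwfMor S T → Set
_≈ˢ_ {S} {T} F G =
  Σ (∀ Γ → F.F₀ Γ ≡ G.F₀ Γ) λ e →
  Σ (∀ {Δ Γ} (γ : CScwf.Sub S Δ Γ) →
       subst₂ (CScwf.Sub T) (e Δ) (e Γ) (F.F₁ γ) ≡ G.F₁ γ) λ _ →
  Σ (∀ A → F.FTy A ≡ G.FTy A) λ eTy →
    ∀ {Γ A} (a : CScwf.Tm S Γ A) →
      subst₂ (CScwf.Tm T) (e Γ) (eTy A) (F.FTm a) ≡ G.FTm a
  where
    module F = ScwfMor F
    module G = ScwfMor G

idˢ : ∀ {S} → ScwfMor S S
idˢ {S} = record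
  { F₀ = λ Γ → Γ ; F₁ = λ γ → γ ; F-id = refl ; F-∘ = λ _ _ → refl
  ; F-◇ = refl ; FTy = λ A → A ; FTm = λ a → a ; FTm-[] = λ _ _ → refl
  ; F-▹ = λ _ _ → refl ; F-p = λ _ _ → refl ; F-q = λ _ _ → refl
  ; F-N₁ = refl ; F-0₁ = λ _ → refl ; F-×ᵗ = λ _ _ → refl
  ; F-fst = λ _ → refl ; F-snd = λ _ → refl ; F-⇒ᵗ = λ _ _ → refl
  ; F-ap = λ _ _ → refl }

_∘ˢ_ : ∀ {S T U} → ScwfMor T U → ScwfMor S T → ScwfMor S U
_∘ˢ_ {S} {T} {U} G F = record
  { F₀ = λ Γ → G.F₀ (F.F₀ Γ)
  ; F₁ = λ γ → G.F₁ (F.F₁ γ)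
  ; F-id = trans (cong G.F₁ F.F-id) G.F-id
  ; F-∘ = λ g f → trans (cong G.F₁ (F.F-∘ g f)) (G.F-∘ (F.F₁ g) (F.F₁ f))
  ; F-◇ = trans (cong G.F₀ F.F-◇) G.F-◇
  ; FTy = λ A → G.FTy (F.FTy A)
  ; FTm = λ a → G.FTm (F.FTm a)
  ; FTm-[] = λ a γ → trans (cong G.FTm (F.FTm-[] a γ)) (G.FTm-[] (F.FTm a) (F.F₁ γ))
  ; F-▹ = H▹
  ; F-p = λ Γ A →
      trans (sym (subst-subst (λ X → U.Sub X (G.F₀ (F.F₀ Γ)))
                   (cong G.F₀ (F.F-▹ Γ A)) (G.F-▹ (F.F₀ Γ) (F.FTy A)) _))
     (trans (cong (subst (λ X → U.Sub X (G.F₀ (F.F₀ Γ))) (G.F-▹ (F.F₀ Γ) (F.FTy A)))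
              (subst-map (λ X → T.Sub X (F.F₀ Γ)) (λ Y → U.Sub Y (G.F₀ (F.F₀ Γ)))
                 G.F₀ G.F₁ (F.F-▹ Γ A) (F.F₁ S.p)))
     (trans (cong (λ u → subst (λ X → U.Sub X (G.F₀ (F.F₀ Γ))) (G.F-▹ (F.F₀ Γ) (F.FTy A)) (G.F₁ u))
              (F.F-p Γ A))
            (G.F-p (F.F₀ Γ) (F.FTy A))))
  ; F-q = λ Γ A →
      trans (sym (subst-subst (λ X → U.Tm X (G.FTy (F.FTy A)))
                   (cong G.F₀ (F.F-▹ Γ A)) (G.F-▹ (F.F₀ Γ) (F.FTy A)) _))
     (trans (cong (subst (λ X → U.Tm X (G.FTy (F.FTy A))) (G.F-▹ (F.F₀ Γ) (F.FTy A)))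
              (subst-map (λ X → T.Tm X (F.FTy A)) (λ Y → U.Tm Y (G.FTy (F.FTy A)))
                 G.F₀ G.FTm (F.F-▹ Γ A) (F.FTm S.q)))
     (trans (cong (λ u → subst (λ X → U.Tm X (G.FTy (F.FTy A))) (G.F-▹ (F.F₀ Γ) (F.FTy A)) (G.FTm u))
              (F.F-q Γ A))
            (G.F-q (F.F₀ Γ) (F.FTy A))))
  ; F-N₁ = trans (cong G.FTy F.F-N₁) G.F-N₁
  ; F-0₁ = λ Γ → U.N₁-η _
  ; F-×ᵗ = H×
  ; F-fst = λ {Γ} {A} {B} c →
      trans (cong G.FTm (F.F-fst c))
     (trans (G.F-fst (subst (T.Tm (F.F₀ Γ)) (F.F-×ᵗ A B) (F.FTm c)))
     (cong U.fst
       (trans (cong (subst (U.Tm (G.F₀ (F.F₀ Γ))) (G.F-×ᵗ (F.FTy A) (F.FTy B)))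
                (sym (subst-map (T.Tm (F.F₀ Γ)) (U.Tm (G.F₀ (F.F₀ Γ))) G.FTy G.FTm
                        (F.F-×ᵗ A B) (F.FTm c))))
              (subst-subst (U.Tm (G.F₀ (F.F₀ Γ))) (cong G.FTy (F.F-×ᵗ A B))
                 (G.F-×ᵗ (F.FTy A) (F.FTy B)) _))))
  ; F-snd = λ {Γ} {A} {B} c →
      trans (cong G.FTm (F.F-snd c))
     (trans (G.F-snd (subst (T.Tm (F.F₀ Γ)) (F.F-×ᵗ A B) (F.FTm c)))
     (cong U.snd
       (trans (cong (subst (U.Tm (G.F₀ (F.F₀ Γ))) (G.F-×ᵗ (F.FTy A) (F.FTy B)))
                (sym (subst-map (T.Tm (F.F₀ Γ)) (U.Tm (G.F₀ (F.F₀ Γ))) G.FTy G.FTm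
                        (F.F-×ᵗ A B) (F.FTm c))))
              (subst-subst (U.Tm (G.F₀ (F.F₀ Γ))) (cong G.FTy (F.F-×ᵗ A B))
                 (G.F-×ᵗ (F.FTy A) (F.FTy B)) _))))
  ; F-⇒ᵗ = H⇒
  ; F-ap = λ {Γ} {A} {B} c a →
      trans (cong G.FTm (F.F-ap c a))
     (trans (G.F-ap (subst (T.Tm (F.F₀ Γ)) (F.F-⇒ᵗ A B) (F.FTm c)) (F.FTm a))
     (cong (λ z → U.ap z (G.FTm (F.FTm a)))
       (trans (cong (subst (U.Tm (G.F₀ (F.F₀ Γ))) (G.F-⇒ᵗ (F.FTy A) (F.FTy B)))
                (sym (subst-map (T.Tm (F.F₀ Γ)) (U.Tm (G.F₀ (F.F₀ Γ))) G.FTy G.FTm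
                        (F.F-⇒ᵗ A B) (F.FTm c))))
              (subst-subst (U.Tm (G.F₀ (F.F₀ Γ))) (cong G.FTy (F.F-⇒ᵗ A B))
                 (G.F-⇒ᵗ (F.FTy A) (F.FTy B)) _))))
  }
  where
    module S = CScwf S
    module T = CScwf T
    module U = CScwf U
    module F = ScwfMor F
    module G = ScwfMor G
    H▹ : ∀ Γ A → G.F₀ (F.F₀ (Γ S.▹ A)) ≡ G.F₀ (F.F₀ Γ) U.▹ G.FTy (F.FTy A)
    H▹ Γ A = trans (cong G.F₀ (F.F-▹ Γ A)) (G.F-▹ (F.F₀ Γ) (F.FTy A))
    H× : ∀ A B → G.FTy (F.FTy (A S.×ᵗ B)) ≡ G.FTy (F.FTy A) U.×ᵗ G.FTy (F.FTy B)
    H× A B = trans (cong G.FTy (F.F-×ᵗ A B)) (G.F-×ᵗ (F.FTy A) (F.FTy B))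
    H⇒ : ∀ A B → G.FTy (F.FTy (A S.⇒ᵗ B)) ≡ G.FTy (F.FTy A) U.⇒ᵗ G.FTy (F.FTy B)
    H⇒ A B = trans (cong G.FTy (F.F-⇒ᵗ A B)) (G.F-⇒ᵗ (F.FTy A) (F.FTy B))

Scwfs-N₁×⇒-ctx : MetaCat
Scwfs-N₁×⇒-ctx = record
  { Obj = CScwf ; Hom = ScwfMor ; _≈_ = _≈ˢ_ ; id = idˢ ; _∘_ = _∘ˢ_
  ; ≈-refl = λ _ → ((λ _ → refl) , (λ _ → refl) , (λ _ → refl) , (λ _ → refl))
  ; identityˡ = λ _ → ((λ _ → refl) , (λ _ → refl) , (λ _ → refl) , (λ _ → refl))
  ; identityʳ = λ _ → ((λ _ → refl) , (λ _ → refl) , (λ _ → refl) , (λ _ → refl))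
  ; assoc = λ _ _ _ → ((λ _ → refl) , (λ _ → refl) , (λ _ → refl) , (λ _ → refl)) }

-- A CCC gives a contextual scwf whose contexts are lists of objects, read as the
-- left-nested products ⊤ × A₁ × … × Aₙ, and whose substitutions and terms are the
-- morphisms out of these products.  A scwf gives the CCC of its types and of its
-- terms in one-variable contexts ◇ ▹ A, composed by substitution.  Going around on
-- the CCC side only replaces A by ⊤ × A.  On the scwf side, contextuality makes every
-- context a telescope ◇ ▹ A₁ ▹ … ▹ Aₙ, and the N₁- and ×-structure make it isomorphic
-- to the one-variable context ◇ ▹ (N₁ ×ᵗ A₁ ×ᵗ … ×ᵗ Aₙ).  As all structure is chosen
-- and preserved on the nose, the rest is transport along equalities of objects.

module Submission where

open import Defs
open import Data.List using (List; []; _∷_; length; map)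
open import Data.List.Properties using (∷-injectiveˡ; ∷-injectiveʳ; map-cong; map-id; map-∘)
open import Data.Nat using (ℕ; zero; suc)
open import Data.Nat.Properties using (suc-injective; 1+n≢0)
open import Data.Empty using (⊥-elim)
open import Data.Product using (Σ; _,_)
open import Relation.Binary.PropositionalEquality hiding ([_])
open ≡-Reasoning

module HomEquality {I J : Set} (H : I → J → Set) where
  infix 4 _≋_
  infixr 5 _∙_

  data _≋_ {i : I} {j : J} (f : H i j) : ∀ {i' j'} → H i' j' → Set where
    ≋-refl : f ≋ f

  _∙_ : ∀ {i j i' j' i'' j''} {f : H i j} {g : H i' j'} {h : H i'' j''} →
        f ≋ g → g ≋ h → f ≋ h
  ≋-refl ∙ ≋-refl = ≋-refl

  ≋-sym : ∀ {i j i' j'} {f : H i j} {g : H i' j'} → f ≋ g → g ≋ f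
  ≋-sym ≋-refl = ≋-refl

  ≋-to-≡ : ∀ {i j} {f g : H i j} → f ≋ g → f ≡ g
  ≋-to-≡ ≋-refl = refl

  ≡-to-≋ : ∀ {i j} {f g : H i j} → f ≡ g → f ≋ g
  ≡-to-≋ refl = ≋-refl

  subst-map-removable : ∀ {K : Set} (f : K → I) (g : K → J) {k k'} (e : k ≡ k')
                        (u : H (f k) (g k)) → subst (λ k → H (f k) (g k)) e u ≋ u
  subst-map-removable f g refl u = ≋-refl

  subst₂-map-removable : ∀ {K L : Set} (f : K → I) (g : L → J) {k k' l l'}
                         (e : k ≡ k') (e' : l ≡ l') (u : H (f k) (g l)) →
                         subst₂ (λ k l → H (f k) (g l)) e e' u ≋ u
  subst₂-map-removable f g refl refl u = ≋-refl

  substˡ-removable : ∀ {i i' j} (e : i ≡ i') (f : H i j) → subst (λ x → H x j) e f ≋ f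
  substˡ-removable refl f = ≋-refl

  substʳ-removable : ∀ {i j j'} (e : j ≡ j') (f : H i j) → subst (H i) e f ≋ f
  substʳ-removable refl f = ≋-refl

  subst₂-removable : ∀ {i i' j j'} (e : i ≡ i') (e' : j ≡ j') (f : H i j) → subst₂ H e e' f ≋ f
  subst₂-removable refl refl f = ≋-refl

module CCCProperties (C : CCC) where
  open CCC C public
  open HomEquality Hom public

  ⟨⟩∘ : ∀ {X Y A B} (f : Hom Y A) (g : Hom Y B) (h : Hom X Y) →
        ⟨ f , g ⟩ ∘ h ≡ ⟨ f ∘ h , g ∘ h ⟩
  ⟨⟩∘ f g h = ⟨⟩-unique _ (trans (sym (assoc _ _ _)) (cong (_∘ h) (fst-β f g)))
                         (trans (sym (assoc _ _ _)) (cong (_∘ h) (snd-β f g)))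

  ⟨fst∘,snd∘⟩ : ∀ {X A B} (h : Hom X (A × B)) → ⟨ fst ∘ h , snd ∘ h ⟩ ≡ h
  ⟨fst∘,snd∘⟩ h = sym (⟨⟩-unique h refl refl)

  ⟨fst,snd⟩ : ∀ {A B} → ⟨ fst {A} {B} , snd ⟩ ≡ id
  ⟨fst,snd⟩ = sym (⟨⟩-unique id (identityʳ _) (identityʳ _))

  ⟨!,⟩∘ : ∀ {X Y A} (f : Hom Y A) (h : Hom X Y) → ⟨ ! , f ⟩ ∘ h ≡ ⟨ ! , f ∘ h ⟩
  ⟨!,⟩∘ f h = trans (⟨⟩∘ _ _ _) (cong ⟨_, f ∘ h ⟩ (!-unique _))

  ×id-∘ : ∀ {X Y A B} (f : Hom Y B) (h : Hom X Y) →
          ⟨ f ∘ fst , snd {Y} {A} ⟩ ∘ ⟨ h ∘ fst , snd {X} {A} ⟩ ≡ ⟨ (f ∘ h) ∘ fst , snd ⟩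
  ×id-∘ f h = trans (⟨⟩∘ _ _ _) (cong₂ ⟨_,_⟩
     (trans (assoc _ _ _) (trans (cong (f ∘_) (fst-β _ _)) (sym (assoc _ _ _))))
     (snd-β _ _))

  curry-∘ : ∀ {X Y A B} (f : Hom (Y × A) B) (h : Hom X Y) →
            curry f ∘ h ≡ curry (f ∘ ⟨ h ∘ fst , snd ⟩)
  curry-∘ f h = curry-unique _ (begin
    eval ∘ ⟨ (curry f ∘ h) ∘ fst , snd ⟩          ≡⟨ cong (eval ∘_) (sym (×id-∘ (curry f) h)) ⟩
    eval ∘ (⟨ curry f ∘ fst , snd ⟩ ∘ ⟨ h ∘ fst , snd ⟩) ≡⟨ sym (assoc _ _ _) ⟩
    (eval ∘ ⟨ curry f ∘ fst , snd ⟩) ∘ ⟨ h ∘ fst , snd ⟩ ≡⟨ cong (_∘ ⟨ h ∘ fst , snd ⟩) (eval-β f) ⟩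
    f ∘ ⟨ h ∘ fst , snd ⟩                           ∎)

  eval-⟨curry,⟩ : ∀ {X A B} (f : Hom (X × A) B) (a : Hom X A) →
                  eval ∘ ⟨ curry f , a ⟩ ≡ f ∘ ⟨ id , a ⟩
  eval-⟨curry,⟩ f a = begin
    eval ∘ ⟨ curry f , a ⟩                            ≡⟨ cong (eval ∘_) (sym ×id-∘⟨id,⟩) ⟩
    eval ∘ (⟨ curry f ∘ fst , snd ⟩ ∘ ⟨ id , a ⟩)     ≡⟨ sym (assoc _ _ _) ⟩
    (eval ∘ ⟨ curry f ∘ fst , snd ⟩) ∘ ⟨ id , a ⟩     ≡⟨ cong (_∘ ⟨ id , a ⟩) (eval-β f) ⟩
    f ∘ ⟨ id , a ⟩                                    ∎
    where
    ×id-∘⟨id,⟩ : ⟨ curry f ∘ fst , snd ⟩ ∘ ⟨ id , a ⟩ ≡ ⟨ curry f , a ⟩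
    ×id-∘⟨id,⟩ = trans (⟨⟩∘ _ _ _) (cong₂ ⟨_,_⟩
      (trans (assoc _ _ _) (trans (cong (curry f ∘_) (fst-β _ _)) (identityʳ _)))
      (snd-β _ _))

  ∘-≋ : ∀ {A B E A' B' E'} {g : Hom B E} {g' : Hom B' E'} {f : Hom A B} {f' : Hom A' B'} →
        g ≋ g' → f ≋ f' → g ∘ f ≋ g' ∘ f'
  ∘-≋ ≋-refl ≋-refl = ≋-refl

  ⟨⟩-≋ : ∀ {X A B X' A' B'} {f : Hom X A} {f' : Hom X' A'} {g : Hom X B} {g' : Hom X' B'} →
         f ≋ f' → g ≋ g' → ⟨ f , g ⟩ ≋ ⟨ f' , g' ⟩
  ⟨⟩-≋ ≋-refl ≋-refl = ≋-refl

  id-≋ : ∀ {A A'} → A ≡ A' → id {A} ≋ id {A'}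
  id-≋ refl = ≋-refl

  fst-≋ : ∀ {A B A' B'} → A ≡ A' → B ≡ B' → fst {A} {B} ≋ fst {A'} {B'}
  fst-≋ refl refl = ≋-refl

  snd-≋ : ∀ {A B A' B'} → A ≡ A' → B ≡ B' → snd {A} {B} ≋ snd {A'} {B'}
  snd-≋ refl refl = ≋-refl

  !-≋ : ∀ {X X' E} → E ≡ ⊤ → X ≡ X' → (f : Hom X E) → f ≋ ! {X'}
  !-≋ refl refl f = ≡-to-≋ (!-unique f)

-- The contextual scwf of a CCC

module ContextScwf (C : CCC) where
  open CCCProperties C

  -- Contexts are lists of objects with the last type at the head: Γ ▹ A is A ∷ Γ.
  ⟦_⟧ : List Obj → Obj
  ⟦ [] ⟧ = ⊤
  ⟦ A ∷ Γ ⟧ = ⟦ Γ ⟧ × A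

  length≡0⇒[] : ∀ {Γ : List Obj} → length Γ ≡ zero → Γ ≡ []
  length≡0⇒[] {[]} _ = refl

  length≡suc⇒∷ : ∀ {Γ : List Obj} {n} → length Γ ≡ suc n →
                 Σ (List Obj) λ Δ → Σ Obj λ A → Σ (Γ ≡ A ∷ Δ) λ _ → length Δ ≡ n
  length≡suc⇒∷ {A ∷ Δ} e = Δ , A , refl , suc-injective e

  scwf : CScwf
  scwf = record
    { Ctx = List Obj ; Sub = λ Δ Γ → Hom ⟦ Δ ⟧ ⟦ Γ ⟧ ; id = id ; _∘_ = _∘_
    ; identityˡ = identityˡ ; identityʳ = identityʳ ; assoc = assoc
    ; ◇ = [] ; ! = ! ; !-unique = !-unique
    ; Ty = Obj ; Tm = λ Γ A → Hom ⟦ Γ ⟧ A ; _[_] = _∘_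
    ; [id] = identityʳ ; [∘] = λ a γ δ → sym (assoc a γ δ)
    ; _▹_ = λ Γ A → A ∷ Γ ; p = fst ; q = snd ; ⟨_,_⟩ = ⟨_,_⟩
    ; p∘⟨⟩ = fst-β ; q[⟨⟩] = snd-β ; ⟨⟩-unique = ⟨⟩-unique
    ; len = length ; len-◇ = refl ; len-zero = length≡0⇒[] ; len-▹ = λ _ _ → refl
    ; len-suc = length≡suc⇒∷ ; ▹-inj-ctx = ∷-injectiveʳ ; ▹-inj-ty = ∷-injectiveˡ
    ; N₁ = ⊤ ; 0₁ = ! ; N₁-η = !-unique
    ; _×ᵗ_ = _×_ ; fst = fst ∘_ ; snd = snd ∘_ ; pair = ⟨_,_⟩
    ; fst-β = fst-β ; snd-β = snd-β ; pair-η = ⟨fst∘,snd∘⟩ ; pair-[] = ⟨⟩∘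
    ; _⇒ᵗ_ = _⇒_ ; lam = curry ; ap = λ c a → eval ∘ ⟨ c , a ⟩
    ; lam-[] = curry-∘
    ; ap-[] = λ c a γ → trans (assoc _ _ _) (cong (eval ∘_) (⟨⟩∘ c a γ))
    ; ⇒-β = eval-⟨curry,⟩
    ; ⇒-η = λ c → sym (curry-unique c refl)
    }

module ScwfProperties (S : CScwf) where
  open CScwf S public
  module Subs = HomEquality Sub
  module Tms = HomEquality Tm
  open Subs public using () renaming (_≋_ to _≋ˢ_)
  open Tms public using () renaming (_≋_ to _≋ᵗ_)

  ⟨⟩∘ : ∀ {Γ Δ Θ A} (γ : Sub Δ Γ) (a : Tm Δ A) (δ : Sub Θ Δ) →
        ⟨ γ , a ⟩ ∘ δ ≡ ⟨ γ ∘ δ , a [ δ ] ⟩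
  ⟨⟩∘ γ a δ = ⟨⟩-unique _ (trans (sym (assoc _ _ _)) (cong (_∘ δ) (p∘⟨⟩ γ a)))
                          (trans ([∘] _ _ _) (cong (_[ δ ]) (q[⟨⟩] γ a)))

  ⟨p∘,q[]⟩ : ∀ {Γ Δ A} (h : Sub Δ (Γ ▹ A)) → ⟨ p ∘ h , q [ h ] ⟩ ≡ h
  ⟨p∘,q[]⟩ h = sym (⟨⟩-unique h refl refl)

  ◇▹-ext : ∀ {Δ X} {σ τ : Sub Δ (◇ ▹ X)} → q [ σ ] ≡ q [ τ ] → σ ≡ τ
  ◇▹-ext {σ = σ} {τ} e = trans (sym (⟨p∘,q[]⟩ σ))
    (trans (cong₂ ⟨_,_⟩ (trans (!-unique _) (sym (!-unique _))) e) (⟨p∘,q[]⟩ τ))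

  ⟨!,⟩∘ : ∀ {Δ Θ A} (a : Tm Δ A) (δ : Sub Θ Δ) → ⟨ ! , a ⟩ ∘ δ ≡ ⟨ ! , a [ δ ] ⟩
  ⟨!,⟩∘ a δ = ◇▹-ext (trans ([∘] _ _ _) (trans (cong (_[ δ ]) (q[⟨⟩] _ _)) (sym (q[⟨⟩] _ _))))

  [⟨!,⟩][] : ∀ {X B Y Θ} (u : Tm (◇ ▹ X) B) (t : Tm Y X) (δ : Sub Θ Y) →
             u [ ⟨ ! , t ⟩ ] [ δ ] ≡ u [ ⟨ ! , t [ δ ] ⟩ ]
  [⟨!,⟩][] u t δ = trans (sym ([∘] _ _ _)) (cong (u [_]) (⟨!,⟩∘ t δ))

  [⟨!,q⟩] : ∀ {A B} (u : Tm (◇ ▹ A) B) → u [ ⟨ ! , q ⟩ ] ≡ u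
  [⟨!,q⟩] u = trans (cong (u [_]) (◇▹-ext (trans (q[⟨⟩] _ _) (sym ([id] q))))) ([id] u)

  fst-[] : ∀ {Γ Δ A B} (c : Tm Γ (A ×ᵗ B)) (γ : Sub Δ Γ) → fst c [ γ ] ≡ fst (c [ γ ])
  fst-[] c γ = begin
    fst c [ γ ]                             ≡⟨ sym (fst-β _ _) ⟩
    fst (pair (fst c [ γ ]) (snd c [ γ ]))  ≡⟨ cong fst (sym (pair-[] _ _ γ)) ⟩
    fst (pair (fst c) (snd c) [ γ ])        ≡⟨ cong (λ z → fst (z [ γ ])) (pair-η c) ⟩
    fst (c [ γ ])                           ∎

  snd-[] : ∀ {Γ Δ A B} (c : Tm Γ (A ×ᵗ B)) (γ : Sub Δ Γ) → snd c [ γ ] ≡ snd (c [ γ ])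
  snd-[] c γ = begin
    snd c [ γ ]                             ≡⟨ sym (snd-β _ _) ⟩
    snd (pair (fst c [ γ ]) (snd c [ γ ]))  ≡⟨ cong snd (sym (pair-[] _ _ γ)) ⟩
    snd (pair (fst c) (snd c) [ γ ])        ≡⟨ cong (λ z → snd (z [ γ ])) (pair-η c) ⟩
    snd (c [ γ ])                           ∎

  fst-q[⟨!,⟩] : ∀ {Θ A B} (c : Tm Θ (A ×ᵗ B)) → fst q [ ⟨ ! , c ⟩ ] ≡ fst c
  fst-q[⟨!,⟩] c = trans (fst-[] _ _) (cong fst (q[⟨⟩] _ _))

  snd-q[⟨!,⟩] : ∀ {Θ A B} (c : Tm Θ (A ×ᵗ B)) → snd q [ ⟨ ! , c ⟩ ] ≡ snd c
  snd-q[⟨!,⟩] c = trans (snd-[] _ _) (cong snd (q[⟨⟩] _ _))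

  fst-q[⟨!,pair⟩] : ∀ {Θ A B} (a : Tm Θ A) (b : Tm Θ B) → fst q [ ⟨ ! , pair a b ⟩ ] ≡ a
  fst-q[⟨!,pair⟩] a b = trans (fst-q[⟨!,⟩] _) (fst-β a b)

  snd-q[⟨!,pair⟩] : ∀ {Θ A B} (a : Tm Θ A) (b : Tm Θ B) → snd q [ ⟨ ! , pair a b ⟩ ] ≡ b
  snd-q[⟨!,pair⟩] a b = trans (snd-q[⟨!,⟩] _) (snd-β a b)

  ap-fst-snd[⟨!,pair⟩] : ∀ {Θ A B} (c : Tm Θ (A ⇒ᵗ B)) (a : Tm Θ A) →
                         ap (fst q) (snd q) [ ⟨ ! , pair c a ⟩ ] ≡ ap c a
  ap-fst-snd[⟨!,pair⟩] c a =
    trans (ap-[] _ _ _) (cong₂ ap (fst-q[⟨!,pair⟩] c a) (snd-q[⟨!,pair⟩] c a))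

  ∘-≋ : ∀ {A B E A' B' E'} {g : Sub B E} {g' : Sub B' E'} {f : Sub A B} {f' : Sub A' B'} →
        g ≋ˢ g' → f ≋ˢ f' → g ∘ f ≋ˢ g' ∘ f'
  ∘-≋ Subs.≋-refl Subs.≋-refl = Subs.≋-refl

  []-≋ : ∀ {Γ A Δ Γ' A' Δ'} {a : Tm Γ A} {a' : Tm Γ' A'} {γ : Sub Δ Γ} {γ' : Sub Δ' Γ'} →
         a ≋ᵗ a' → γ ≋ˢ γ' → a [ γ ] ≋ᵗ a' [ γ' ]
  []-≋ Tms.≋-refl Subs.≋-refl = Tms.≋-refl

  ⟨⟩-≋ : ∀ {Γ A Δ Γ' A' Δ'} {γ : Sub Δ Γ} {γ' : Sub Δ' Γ'} {a : Tm Δ A} {a' : Tm Δ' A'} →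
         γ ≋ˢ γ' → a ≋ᵗ a' → ⟨ γ , a ⟩ ≋ˢ ⟨ γ' , a' ⟩
  ⟨⟩-≋ Subs.≋-refl Tms.≋-refl = Subs.≋-refl

  p-≋ : ∀ {Γ Γ' A A'} → Γ ≡ Γ' → A ≡ A' → p {Γ} {A} ≋ˢ p {Γ'} {A'}
  p-≋ refl refl = Subs.≋-refl

  q-≋ : ∀ {Γ Γ' A A'} → Γ ≡ Γ' → A ≡ A' → q {Γ} {A} ≋ᵗ q {Γ'} {A'}
  q-≋ refl refl = Tms.≋-refl

  id-≋ : ∀ {Γ Γ'} → Γ ≡ Γ' → id {Γ} ≋ˢ id {Γ'}
  id-≋ refl = Subs.≋-refl

  !-≋ : ∀ {X X' E} → E ≡ ◇ → X ≡ X' → (σ : Sub X E) → σ ≋ˢ ! {X'}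
  !-≋ refl refl σ = Subs.≡-to-≋ (!-unique σ)

  0₁-≋ : ∀ {Γ Γ'} → Γ ≡ Γ' → 0₁ {Γ} ≋ᵗ 0₁ {Γ'}
  0₁-≋ refl = Tms.≋-refl

  fst-≋ : ∀ {Γ Γ' A A' B B'} {c : Tm Γ (A ×ᵗ B)} {c' : Tm Γ' (A' ×ᵗ B')} →
          A ≡ A' → B ≡ B' → c ≋ᵗ c' → fst c ≋ᵗ fst c'
  fst-≋ refl refl Tms.≋-refl = Tms.≋-refl

  snd-≋ : ∀ {Γ Γ' A A' B B'} {c : Tm Γ (A ×ᵗ B)} {c' : Tm Γ' (A' ×ᵗ B')} →
          A ≡ A' → B ≡ B' → c ≋ᵗ c' → snd c ≋ᵗ snd c'
  snd-≋ refl refl Tms.≋-refl = Tms.≋-refl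

  pair-≋ : ∀ {Γ Γ' A A' B B'} {a : Tm Γ A} {a' : Tm Γ' A'} {b : Tm Γ B} {b' : Tm Γ' B'} →
           a ≋ᵗ a' → b ≋ᵗ b' → pair a b ≋ᵗ pair a' b'
  pair-≋ Tms.≋-refl Tms.≋-refl = Tms.≋-refl

  ap-≋ : ∀ {Γ Γ' A A' B B'} {c : Tm Γ (A ⇒ᵗ B)} {c' : Tm Γ' (A' ⇒ᵗ B')} {a : Tm Γ A} {a' : Tm Γ' A'} →
         B ≡ B' → c ≋ᵗ c' → a ≋ᵗ a' → ap c a ≋ᵗ ap c' a'
  ap-≋ refl Tms.≋-refl Tms.≋-refl = Tms.≋-refl

-- The CCC of types and terms in one-variable contexts

module UnaryCCC (S : CScwf) where
  open ScwfProperties S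

  Hom : Ty → Ty → Set
  Hom A B = Tm (◇ ▹ A) B

  infixr 9 _∘₁_
  _∘₁_ : ∀ {A B C} → Hom B C → Hom A B → Hom A C
  g ∘₁ f = g [ ⟨ ! , f ⟩ ]

  ∘₁-assoc : ∀ {A B C D} (h : Hom C D) (g : Hom B C) (f : Hom A B) →
             (h ∘₁ g) ∘₁ f ≡ h ∘₁ (g ∘₁ f)
  ∘₁-assoc h g f = [⟨!,⟩][] h g _

  eval₁ : ∀ {A B} → Hom ((A ⇒ᵗ B) ×ᵗ A) B
  eval₁ = ap (fst q) (snd q)

  uncurrying : ∀ {C A} → Sub (◇ ▹ C ▹ A) (◇ ▹ (C ×ᵗ A))
  uncurrying = ⟨ ! , pair (q [ p ]) q ⟩

  curry₁ : ∀ {C A B} → Hom (C ×ᵗ A) B → Hom C (A ⇒ᵗ B)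
  curry₁ f = lam (f [ uncurrying ])

  uncurrying∘⟨⟨!,⟩,⟩ : ∀ {Θ C A} (c : Tm Θ C) (a : Tm Θ A) →
                       uncurrying ∘ ⟨ ⟨ ! , c ⟩ , a ⟩ ≡ ⟨ ! , pair c a ⟩
  uncurrying∘⟨⟨!,⟩,⟩ c a =
    trans (⟨!,⟩∘ _ _) (cong ⟨ ! ,_⟩ (trans (pair-[] _ _ _) (cong₂ pair q[p][⟨⟩] (q[⟨⟩] _ _))))
    where
    q[p][⟨⟩] : q [ p ] [ ⟨ ⟨ ! , c ⟩ , a ⟩ ] ≡ c
    q[p][⟨⟩] = trans (sym ([∘] _ _ _)) (trans (cong (q [_]) (p∘⟨⟩ _ _)) (q[⟨⟩] _ _))

  eval₁∘₁×id : ∀ {C A B} (h : Hom C (A ⇒ᵗ B)) →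
               eval₁ ∘₁ pair (h ∘₁ fst q) (snd q) ≡ ap (h ∘₁ fst q) (snd q)
  eval₁∘₁×id h = ap-fst-snd[⟨!,pair⟩] (h ∘₁ fst q) (snd q)

  eval₁-β : ∀ {C A B} (f : Hom (C ×ᵗ A) B) → eval₁ ∘₁ pair (curry₁ f ∘₁ fst q) (snd q) ≡ f
  eval₁-β f = begin
    eval₁ ∘₁ pair (curry₁ f ∘₁ fst q) (snd q)     ≡⟨ eval₁∘₁×id (curry₁ f) ⟩
    ap (lam (f [ uncurrying ]) [ ⟨ ! , fst q ⟩ ]) (snd q)
      ≡⟨ cong (λ z → ap z (snd q)) (lam-[] _ _) ⟩
    ap (lam (f [ uncurrying ] [ ⟨ ⟨ ! , fst q ⟩ ∘ p , q ⟩ ])) (snd q) ≡⟨ ⇒-β _ _ ⟩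
    f [ uncurrying ] [ ⟨ ⟨ ! , fst q ⟩ ∘ p , q ⟩ ] [ ⟨ id , snd q ⟩ ]
      ≡⟨ trans (sym ([∘] _ _ _)) (sym ([∘] _ _ _)) ⟩
    f [ uncurrying ∘ (⟨ ⟨ ! , fst q ⟩ ∘ p , q ⟩ ∘ ⟨ id , snd q ⟩) ]
      ≡⟨ cong (λ σ → f [ uncurrying ∘ σ ]) lift∘⟨id,⟩ ⟩
    f [ uncurrying ∘ ⟨ ⟨ ! , fst q ⟩ , snd q ⟩ ] ≡⟨ cong (f [_]) (uncurrying∘⟨⟨!,⟩,⟩ _ _) ⟩
    f [ ⟨ ! , pair (fst q) (snd q) ⟩ ]           ≡⟨ cong (λ z → f [ ⟨ ! , z ⟩ ]) (pair-η q) ⟩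
    f [ ⟨ ! , q ⟩ ]                               ≡⟨ [⟨!,q⟩] f ⟩
    f                                             ∎
    where
    lift∘⟨id,⟩ : ⟨ ⟨ ! , fst q ⟩ ∘ p , q ⟩ ∘ ⟨ id , snd q ⟩ ≡ ⟨ ⟨ ! , fst q ⟩ , snd q ⟩
    lift∘⟨id,⟩ = trans (⟨⟩∘ _ _ _) (cong₂ ⟨_,_⟩
      (trans (assoc _ _ _) (trans (cong (_ ∘_) (p∘⟨⟩ _ _)) (identityʳ _)))
      (q[⟨⟩] _ _))

  curry₁-unique : ∀ {C A B} {f : Hom (C ×ᵗ A) B} (h : Hom C (A ⇒ᵗ B)) →
                  eval₁ ∘₁ pair (h ∘₁ fst q) (snd q) ≡ f → h ≡ curry₁ f
  curry₁-unique {f = f} h e = trans (sym (⇒-η h)) (cong lam (begin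
    ap (h [ p ]) q                                   ≡⟨ cong (λ σ → ap (h [ σ ]) q) (sym ⟨!,q[p]⟩) ⟩
    ap (h [ ⟨ ! , q [ p ] ⟩ ]) q                      ≡⟨ sym ap-h∘₁fst-snd[uncurrying] ⟩
    ap (h ∘₁ fst q) (snd q) [ uncurrying ]          ≡⟨ cong (_[ uncurrying ]) (trans (sym (eval₁∘₁×id h)) e) ⟩
    f [ uncurrying ]                                ∎))
    where
    ⟨!,q[p]⟩ : ⟨ ! , q [ p ] ⟩ ≡ p
    ⟨!,q[p]⟩ = ◇▹-ext (q[⟨⟩] _ _)
    ap-h∘₁fst-snd[uncurrying] : ap (h ∘₁ fst q) (snd q) [ uncurrying ] ≡ ap (h [ ⟨ ! , q [ p ] ⟩ ]) q
    ap-h∘₁fst-snd[uncurrying] = trans (ap-[] _ _ _) (cong₂ ap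
      (trans ([⟨!,⟩][] h _ _) (cong (λ z → h [ ⟨ ! , z ⟩ ]) (fst-q[⟨!,pair⟩] _ _)))
      (snd-q[⟨!,pair⟩] _ _))

  ccc : CCC
  ccc = record
    { Obj = Ty ; Hom = Hom ; id = q ; _∘_ = _∘₁_
    ; identityˡ = λ f → q[⟨⟩] _ _ ; identityʳ = [⟨!,q⟩] ; assoc = ∘₁-assoc
    ; ⊤ = N₁ ; ! = 0₁ ; !-unique = N₁-η
    ; _×_ = _×ᵗ_ ; fst = fst q ; snd = snd q ; ⟨_,_⟩ = pair
    ; fst-β = fst-q[⟨!,pair⟩] ; snd-β = snd-q[⟨!,pair⟩]
    ; ⟨⟩-unique = λ h e₁ e₂ → trans (sym (pair-η h)) (cong₂ pair
        (trans (sym (fst-q[⟨!,⟩] h)) e₁) (trans (sym (snd-q[⟨!,⟩] h)) e₂))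
    ; _⇒_ = _⇒ᵗ_ ; eval = eval₁ ; curry = curry₁
    ; eval-β = eval₁-β ; curry-unique = curry₁-unique
    }

module CCCMorProperties {C D : CCC} (F : CCCMor C D) where
  private
    module C = CCCProperties C
  module D = CCCProperties D
  open CCCMor F public
  open D using (_≋_; ≋-refl; _∙_; ≋-sym; ≡-to-≋; ≋-to-≡)

  F₁-≋ : ∀ {A B A' B'} {f : C.Hom A B} {f' : C.Hom A' B'} → f C.≋ f' → F₁ f ≋ F₁ f'
  F₁-≋ C.≋-refl = ≋-refl

  F₁-∘ : ∀ {A B E} (g : C.Hom B E) (f : C.Hom A B) → F₁ (g C.∘ f) ≋ F₁ g D.∘ F₁ f
  F₁-∘ g f = ≡-to-≋ (F-∘ g f)

  F₁-fst : ∀ {A B} → F₁ (C.fst {A} {B}) ≋ D.fst {F₀ A} {F₀ B}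
  F₁-fst {A} {B} = ≋-sym (D.substˡ-removable (F-× A B) _) ∙ ≡-to-≋ (F-fst A B)

  F₁-snd : ∀ {A B} → F₁ (C.snd {A} {B}) ≋ D.snd {F₀ A} {F₀ B}
  F₁-snd {A} {B} = ≋-sym (D.substˡ-removable (F-× A B) _) ∙ ≡-to-≋ (F-snd A B)

  F₁-eval : ∀ {A B} → F₁ (C.eval {A} {B}) ≋ D.eval {F₀ A} {F₀ B}
  F₁-eval {A} {B} = ≋-sym (D.substˡ-removable _ _) ∙ ≡-to-≋ (F-eval A B)

  F₁-⟨⟩ : ∀ {X A B} (f : C.Hom X A) (g : C.Hom X B) → F₁ C.⟨ f , g ⟩ ≋ D.⟨ F₁ f , F₁ g ⟩
  F₁-⟨⟩ {X} {A} {B} f g = ≋-sym (D.substʳ-removable (F-× A B) _) ∙ ≡-to-≋ (D.⟨⟩-unique _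
     (≋-to-≡ (D.∘-≋ (≋-sym F₁-fst) (D.substʳ-removable (F-× A B) _) ∙ ≋-sym (F₁-∘ _ _) ∙
              F₁-≋ (C.≡-to-≋ (C.fst-β f g))))
     (≋-to-≡ (D.∘-≋ (≋-sym F₁-snd) (D.substʳ-removable (F-× A B) _) ∙ ≋-sym (F₁-∘ _ _) ∙
              F₁-≋ (C.≡-to-≋ (C.snd-β f g)))))

module ScwfMorProperties {S T : CScwf} (F : ScwfMor S T) where
  private
    module S = ScwfProperties S
  module T = ScwfProperties T
  open ScwfMor F public
  open T using (_≋ˢ_; _≋ᵗ_)
  open T.Subs using () renaming (_∙_ to _∙ˢ_; ≋-sym to ≋ˢ-sym; ≡-to-≋ to ≡-to-≋ˢ; ≋-to-≡ to ≋ˢ-to-≡)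
  open T.Tms using (_∙_; ≋-sym; ≡-to-≋; ≋-to-≡)

  F₁-≋ : ∀ {A B A' B'} {f : S.Sub A B} {f' : S.Sub A' B'} → f S.≋ˢ f' → F₁ f ≋ˢ F₁ f'
  F₁-≋ S.Subs.≋-refl = T.Subs.≋-refl

  FTm-≋ : ∀ {A B A' B'} {a : S.Tm A B} {a' : S.Tm A' B'} → a S.≋ᵗ a' → FTm a ≋ᵗ FTm a'
  FTm-≋ S.Tms.≋-refl = T.Tms.≋-refl

  F₁-∘ : ∀ {Γ Δ Θ} (g : S.Sub Δ Θ) (f : S.Sub Γ Δ) → F₁ (g S.∘ f) ≋ˢ F₁ g T.∘ F₁ f
  F₁-∘ g f = ≡-to-≋ˢ (F-∘ g f)

  FTm-[]≋ : ∀ {Γ Δ A} (a : S.Tm Γ A) (γ : S.Sub Δ Γ) → FTm (a S.[ γ ]) ≋ᵗ FTm a T.[ F₁ γ ]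
  FTm-[]≋ a γ = ≡-to-≋ (FTm-[] a γ)

  F₁-p : ∀ {Γ A} → F₁ (S.p {Γ} {A}) ≋ˢ T.p {F₀ Γ} {FTy A}
  F₁-p {Γ} {A} = ≋ˢ-sym (T.Subs.substˡ-removable (F-▹ Γ A) _) ∙ˢ ≡-to-≋ˢ (F-p Γ A)

  FTm-q : ∀ {Γ A} → FTm (S.q {Γ} {A}) ≋ᵗ T.q {F₀ Γ} {FTy A}
  FTm-q {Γ} {A} = ≋-sym (T.Tms.substˡ-removable (F-▹ Γ A) _) ∙ ≡-to-≋ (F-q Γ A)

  FTm-0₁ : ∀ {Γ} → FTm (S.0₁ {Γ}) ≋ᵗ T.0₁ {F₀ Γ}
  FTm-0₁ {Γ} = ≋-sym (T.Tms.substʳ-removable F-N₁ _) ∙ ≡-to-≋ (F-0₁ Γ)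

  F₁-⟨⟩ : ∀ {Γ Δ A} (γ : S.Sub Δ Γ) (a : S.Tm Δ A) → F₁ S.⟨ γ , a ⟩ ≋ˢ T.⟨ F₁ γ , FTm a ⟩
  F₁-⟨⟩ {Γ} {Δ} {A} γ a = ≋ˢ-sym (T.Subs.substʳ-removable (F-▹ Γ A) _) ∙ˢ ≡-to-≋ˢ (T.⟨⟩-unique _
     (≋ˢ-to-≡ (T.∘-≋ (≋ˢ-sym F₁-p) (T.Subs.substʳ-removable (F-▹ Γ A) _) ∙ˢ ≋ˢ-sym (F₁-∘ _ _) ∙ˢ
               F₁-≋ (S.Subs.≡-to-≋ (S.p∘⟨⟩ γ a))))
     (≋-to-≡ (T.[]-≋ (≋-sym FTm-q) (T.Subs.substʳ-removable (F-▹ Γ A) _) ∙ ≋-sym (FTm-[]≋ _ _) ∙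
              FTm-≋ (S.Tms.≡-to-≋ (S.q[⟨⟩] γ a)))))

  FTm-fst : ∀ {Γ A B Θ A' B'} (c : S.Tm Γ (A S.×ᵗ B)) {c' : T.Tm Θ (A' T.×ᵗ B')} →
            FTy A ≡ A' → FTy B ≡ B' → FTm c ≋ᵗ c' → FTm (S.fst c) ≋ᵗ T.fst c'
  FTm-fst {A = A} {B} c eA eB e = ≡-to-≋ (F-fst c) ∙ T.fst-≋ eA eB (T.Tms.substʳ-removable (F-×ᵗ A B) _ ∙ e)

  FTm-snd : ∀ {Γ A B Θ A' B'} (c : S.Tm Γ (A S.×ᵗ B)) {c' : T.Tm Θ (A' T.×ᵗ B')} →
            FTy A ≡ A' → FTy B ≡ B' → FTm c ≋ᵗ c' → FTm (S.snd c) ≋ᵗ T.snd c'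
  FTm-snd {A = A} {B} c eA eB e = ≡-to-≋ (F-snd c) ∙ T.snd-≋ eA eB (T.Tms.substʳ-removable (F-×ᵗ A B) _ ∙ e)

  FTm-ap : ∀ {Γ A B Θ A' B'} (c : S.Tm Γ (A S.⇒ᵗ B)) (a : S.Tm Γ A)
           {c' : T.Tm Θ (A' T.⇒ᵗ B')} {a' : T.Tm Θ A'} →
           FTy B ≡ B' → FTm c ≋ᵗ c' → FTm a ≋ᵗ a' → FTm (S.ap c a) ≋ᵗ T.ap c' a'
  FTm-ap {A = A} {B} c a eB ec ea =
    ≡-to-≋ (F-ap c a) ∙ T.ap-≋ eB (T.Tms.substʳ-removable (F-⇒ᵗ A B) _ ∙ ec) ea

  FTm-pair : ∀ {Γ A B} (a : S.Tm Γ A) (b : S.Tm Γ B) → FTm (S.pair a b) ≋ᵗ T.pair (FTm a) (FTm b)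
  FTm-pair {Γ} {A} {B} a b =
    ≋-sym (T.Tms.substʳ-removable (F-×ᵗ A B) _) ∙ ≡-to-≋ (trans (sym (T.pair-η _)) (cong₂ T.pair
      (≋-to-≡ (≋-sym (FTm-fst (S.pair a b) refl refl transported) ∙ FTm-≋ (S.Tms.≡-to-≋ (S.fst-β a b))))
      (≋-to-≡ (≋-sym (FTm-snd (S.pair a b) refl refl transported) ∙ FTm-≋ (S.Tms.≡-to-≋ (S.snd-β a b))))))
    where
    transported : FTm (S.pair a b) ≋ᵗ subst (T.Tm (F₀ Γ)) (F-×ᵗ A B) (FTm (S.pair a b))
    transported = ≋-sym (T.Tms.substʳ-removable (F-×ᵗ A B) _)

-- The functors

module ContextScwfMor {C D : CCC} (F : CCCMor C D) where
  private
    module C = ContextScwf C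
    module D′ = ContextScwf D
  open CCCMorProperties F
  open D using (_∙_; ≋-sym; ≡-to-≋; ≋-to-≡; subst₂-removable)

  F-⟦⟧ : ∀ Γ → F₀ C.⟦ Γ ⟧ ≡ D′.⟦ map F₀ Γ ⟧
  F-⟦⟧ [] = F-⊤
  F-⟦⟧ (A ∷ Γ) = trans (F-× _ A) (cong (D._× F₀ A) (F-⟦⟧ Γ))

  scwfMor : ScwfMor C.scwf D′.scwf
  scwfMor = record
    { F₀ = map F₀
    ; F₁ = λ {Δ} {Γ} γ → subst₂ D.Hom (F-⟦⟧ Δ) (F-⟦⟧ Γ) (F₁ γ)
    ; F-id = λ {Γ} → ≋-to-≡ (subst₂-removable _ _ _ ∙ ≡-to-≋ F-id ∙ D.id-≋ (F-⟦⟧ Γ))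
    ; F-∘ = λ g f → ≋-to-≡ (subst₂-removable _ _ _ ∙ F₁-∘ g f ∙
         D.∘-≋ (≋-sym (subst₂-removable _ _ _)) (≋-sym (subst₂-removable _ _ _)))
    ; F-◇ = refl
    ; FTy = F₀
    ; FTm = λ {Γ} a → subst₂ D.Hom (F-⟦⟧ Γ) refl (F₁ a)
    ; FTm-[] = λ a γ → ≋-to-≡ (subst₂-removable _ _ _ ∙ F₁-∘ a γ ∙
         D.∘-≋ (≋-sym (subst₂-removable _ _ _)) (≋-sym (subst₂-removable _ _ _)))
    ; F-▹ = λ _ _ → refl
    ; F-p = λ Γ A → ≋-to-≡ (subst₂-removable _ _ _ ∙ F₁-fst ∙ D.fst-≋ (F-⟦⟧ Γ) refl)
    ; F-q = λ Γ A → ≋-to-≡ (subst₂-removable _ _ _ ∙ F₁-snd ∙ D.snd-≋ (F-⟦⟧ Γ) refl)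
    ; F-N₁ = F-⊤
    ; F-0₁ = λ Γ → D.!-unique _
    ; F-×ᵗ = F-×
    ; F-fst = λ {Γ} {A} {B} c → ≋-to-≡ (subst₂-removable _ _ _ ∙ F₁-∘ _ _ ∙
         D.∘-≋ F₁-fst (≋-sym (subst₂-removable _ _ _) ∙ ≋-sym (D.substʳ-removable (F-× A B) _)))
    ; F-snd = λ {Γ} {A} {B} c → ≋-to-≡ (subst₂-removable _ _ _ ∙ F₁-∘ _ _ ∙
         D.∘-≋ F₁-snd (≋-sym (subst₂-removable _ _ _) ∙ ≋-sym (D.substʳ-removable (F-× A B) _)))
    ; F-⇒ᵗ = F-⇒
    ; F-ap = λ {Γ} {A} {B} c a → ≋-to-≡ (subst₂-removable _ _ _ ∙ F₁-∘ _ _ ∙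
         D.∘-≋ F₁-eval (F₁-⟨⟩ c a ∙
           D.⟨⟩-≋ (≋-sym (subst₂-removable _ _ _) ∙ ≋-sym (D.substʳ-removable (F-⇒ A B) _))
                  (≋-sym (subst₂-removable _ _ _))))
    }

module UnaryCCCMor {S T : CScwf} (F : ScwfMor S T) where
  private
    module S = ScwfProperties S
    module S₁ = UnaryCCC S
    module T₁ = UnaryCCC T
  open ScwfMorProperties F
  open T using (_≋ᵗ_)
  open T.Tms using (_∙_; ≋-sym; ≋-to-≡)

  F-◇▹ : ∀ A → F₀ (S.◇ S.▹ A) ≡ T.◇ T.▹ FTy A
  F-◇▹ A = trans (F-▹ S.◇ A) (cong (T._▹ FTy A) F-◇)

  onHom : ∀ {A B} → S₁.Hom A B → T₁.Hom (FTy A) (FTy B)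
  onHom {A} {B} a = subst (λ X → T.Tm X (FTy B)) (F-◇▹ A) (FTm a)

  onHom-≋ : ∀ {A B} (a : S₁.Hom A B) → onHom a ≋ᵗ FTm a
  onHom-≋ {A} a = T.Tms.substˡ-removable (F-◇▹ A) _

  FTm-q₁ : ∀ {A A'} → FTy A ≡ A' → FTm (S.q {S.◇} {A}) ≋ᵗ T.q {T.◇} {A'}
  FTm-q₁ e = FTm-q ∙ T.q-≋ F-◇ e

  onHom-retype : ∀ {A A' B} (e : A ≡ A') (u : T₁.Hom A B) →
                 subst (λ X → T₁.Hom X B) e u ≋ᵗ u
  onHom-retype e u = T.Tms.subst-map-removable (T._▹_ T.◇) (λ _ → _) e u

  cccMor : CCCMor S₁.ccc T₁.ccc
  cccMor = record
    { F₀ = FTy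
    ; F₁ = onHom
    ; F-id = ≋-to-≡ (onHom-≋ _ ∙ FTm-q₁ refl)
    ; F-∘ = λ {A} g f → ≋-to-≡ (onHom-≋ _ ∙ FTm-[]≋ g _ ∙ T.[]-≋ (≋-sym (onHom-≋ g))
              (F₁-⟨⟩ _ _ T.Subs.∙ T.⟨⟩-≋ (T.!-≋ F-◇ (F-◇▹ A) _) (≋-sym (onHom-≋ f))))
    ; F-⊤ = F-N₁
    ; F-× = F-×ᵗ
    ; F-fst = λ A B → ≋-to-≡ (onHom-retype (F-×ᵗ A B) _ ∙ onHom-≋ _ ∙
         FTm-fst S.q refl refl (FTm-q₁ (F-×ᵗ A B)))
    ; F-snd = λ A B → ≋-to-≡ (onHom-retype (F-×ᵗ A B) _ ∙ onHom-≋ _ ∙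
         FTm-snd S.q refl refl (FTm-q₁ (F-×ᵗ A B)))
    ; F-⇒ = F-⇒ᵗ
    ; F-eval = λ A B → let e = trans (F-×ᵗ _ A) (cong (T._×ᵗ FTy A) (F-⇒ᵗ A B)) in
        ≋-to-≡ (onHom-retype e _ ∙ onHom-≋ _ ∙
          FTm-ap (S.fst S.q) (S.snd S.q) refl
            (FTm-fst S.q (F-⇒ᵗ A B) refl (FTm-q₁ e))
            (FTm-snd S.q (F-⇒ᵗ A B) refl (FTm-q₁ e)))
    }

scwfMor-resp-≈ : ∀ {C D} (F G : CCCMor C D) → F ≈ᶜ G →
                 ContextScwfMor.scwfMor F ≈ˢ ContextScwfMor.scwfMor G
scwfMor-resp-≈ {C} {D} F G (e₀ , e₁) =
    map-cong e₀
  , (λ {Δ} {Γ} γ → ≋-to-≡ (subst₂-map-removable ⟦_⟧ ⟦_⟧ (map-cong e₀ Δ) (map-cong e₀ Γ) _ ∙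
        subst₂-removable (F-⟦⟧ F Δ) (F-⟦⟧ F Γ) _ ∙ ≋-sym (subst₂-removable (e₀ _) (e₀ _) _) ∙
        ≡-to-≋ (e₁ γ) ∙ ≋-sym (subst₂-removable (F-⟦⟧ G Δ) (F-⟦⟧ G Γ) _)))
  , e₀
  , (λ {Γ} {A} a → ≋-to-≡ (subst₂-map-removable ⟦_⟧ (λ X → X) (map-cong e₀ Γ) (e₀ A) _ ∙
        subst₂-removable (F-⟦⟧ F Γ) refl _ ∙ ≋-sym (subst₂-removable (e₀ _) (e₀ _) _) ∙
        ≡-to-≋ (e₁ a) ∙ ≋-sym (subst₂-removable (F-⟦⟧ G Γ) refl _)))
  where
  open CCCProperties D
  open ContextScwf D using (⟦_⟧)
  open ContextScwfMor using (F-⟦⟧)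

scwfMor-id : ∀ C → ContextScwfMor.scwfMor (idᶜ {C}) ≈ˢ idˢ
scwfMor-id C =
    map-id
  , (λ {Δ} {Γ} γ → ≋-to-≡ (subst₂-map-removable ⟦_⟧ ⟦_⟧ (map-id Δ) (map-id Γ) _ ∙ subst₂-removable _ _ _))
  , (λ _ → refl)
  , (λ {Γ} a → ≋-to-≡ (subst₂-map-removable ⟦_⟧ (λ X → X) (map-id Γ) refl _ ∙ subst₂-removable _ _ _))
  where
  open CCCProperties C
  open ContextScwf C using (⟦_⟧)

scwfMor-∘ : ∀ {C D E} (G : CCCMor D E) (F : CCCMor C D) →
            ContextScwfMor.scwfMor (G ∘ᶜ F) ≈ˢ (ContextScwfMor.scwfMor G ∘ˢ ContextScwfMor.scwfMor F)
scwfMor-∘ {C} {D} {E} G F =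
    map-∘
  , (λ {Δ} {Γ} γ → ≋-to-≡ (subst₂-map-removable ⟦_⟧ ⟦_⟧ (map-∘ Δ) (map-∘ Γ) _ ∙
        subst₂-removable (F-⟦⟧ (G ∘ᶜ F) Δ) (F-⟦⟧ (G ∘ᶜ F) Γ) _ ∙
        G.F₁-≋ (D.≋-sym (D.subst₂-removable (F-⟦⟧ F Δ) (F-⟦⟧ F Γ) _)) ∙
        ≋-sym (subst₂-removable (F-⟦⟧ G (map F.F₀ Δ)) (F-⟦⟧ G (map F.F₀ Γ)) _)))
  , (λ _ → refl)
  , (λ {Γ} a → ≋-to-≡ (subst₂-map-removable ⟦_⟧ (λ X → X) (map-∘ Γ) refl _ ∙
        subst₂-removable (F-⟦⟧ (G ∘ᶜ F) Γ) refl _ ∙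
        G.F₁-≋ (D.≋-sym (D.subst₂-removable (F-⟦⟧ F Γ) refl _)) ∙
        ≋-sym (subst₂-removable (F-⟦⟧ G (map F.F₀ Γ)) refl _)))
  where
  open CCCProperties E
  open ContextScwf E using (⟦_⟧)
  open ContextScwfMor using (F-⟦⟧)
  module D = CCCProperties D
  module G = CCCMorProperties G
  module F = CCCMor F

CCCs⇒Scwfs : MetaFunctor CCCs Scwfs-N₁×⇒-ctx
CCCs⇒Scwfs = record
  { F₀ = ContextScwf.scwf
  ; F₁ = ContextScwfMor.scwfMor
  ; F-resp-≈ = λ {_} {_} {F} {G} → scwfMor-resp-≈ F G
  ; F-id = λ {C} → scwfMor-id C
  ; F-∘ = scwfMor-∘
  }

cccMor-resp-≈ : ∀ {S T} (F G : ScwfMor S T) → F ≈ˢ G → UnaryCCCMor.cccMor F ≈ᶜ UnaryCCCMor.cccMor G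
cccMor-resp-≈ {S} {T} F G (e₀ , _ , eTy , eTm) =
    eTy
  , (λ {A} {B} a → ≋-to-≡ (subst₂-map-removable (◇ ▹_) (λ X → X) _ _ _ ∙
       F.onHom-≋ a ∙ ≋-sym (subst₂-removable (e₀ _) (eTy B) _) ∙ ≡-to-≋ (eTm a) ∙
       ≋-sym (G.onHom-≋ a)))
  where
  open ScwfProperties T
  open Tms using (_∙_; ≋-sym; ≡-to-≋; ≋-to-≡; subst₂-removable; subst₂-map-removable)
  module F = UnaryCCCMor F
  module G = UnaryCCCMor G

cccMor-∘ : ∀ {S T U} (G : ScwfMor T U) (F : ScwfMor S T) →
           UnaryCCCMor.cccMor (G ∘ˢ F) ≈ᶜ (UnaryCCCMor.cccMor G ∘ᶜ UnaryCCCMor.cccMor F)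
cccMor-∘ {S} {T} {U} G F =
    (λ _ → refl)
  , (λ a → ≋-to-≡ (GF.onHom-≋ a ∙ G′.FTm-≋ (T.Tms.≋-sym (F.onHom-≋ a)) ∙ ≋-sym (G.onHom-≋ _)))
  where
  open ScwfProperties U
  open Tms using (_∙_; ≋-sym; ≋-to-≡)
  module T = ScwfProperties T
  module G′ = ScwfMorProperties G
  module GF = UnaryCCCMor (G ∘ˢ F)
  module G = UnaryCCCMor G
  module F = UnaryCCCMor F

Scwfs⇒CCCs : MetaFunctor Scwfs-N₁×⇒-ctx CCCs
Scwfs⇒CCCs = record
  { F₀ = UnaryCCC.ccc
  ; F₁ = UnaryCCCMor.cccMor
  ; F-resp-≈ = λ {_} {_} {F} {G} → cccMor-resp-≈ F G
  ; F-id = (λ _ → refl) , (λ _ → refl)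
  ; F-∘ = cccMor-∘
  }

-- The unit

module Unit (C : CCC) where
  open CCCProperties C

  unit : CCCMor C (UnaryCCC.ccc (ContextScwf.scwf C))
  unit = record
    { F₀ = λ A → A ; F₁ = λ f → f ∘ snd
    ; F-id = identityˡ _
    ; F-∘ = λ g f → trans (assoc _ _ _) (sym (trans (assoc _ _ _) (cong (g ∘_) (snd-β _ _))))
    ; F-⊤ = refl ; F-× = λ _ _ → refl ; F-fst = λ _ _ → refl ; F-snd = λ _ _ → refl
    ; F-⇒ = λ _ _ → refl
    ; F-eval = λ A B → cong (eval ∘_) (sym (⟨fst∘,snd∘⟩ snd))
    }

  ∘⟨!,id⟩-∘₁ : ∀ {A B E} (g : Hom (⊤ × B) E) (f : Hom (⊤ × A) B) →
               (g ∘ ⟨ ! , f ⟩) ∘ ⟨ ! , id ⟩ ≡ (g ∘ ⟨ ! , id ⟩) ∘ (f ∘ ⟨ ! , id ⟩)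
  ∘⟨!,id⟩-∘₁ g f = begin
    (g ∘ ⟨ ! , f ⟩) ∘ ⟨ ! , id ⟩          ≡⟨ assoc _ _ _ ⟩
    g ∘ (⟨ ! , f ⟩ ∘ ⟨ ! , id ⟩)          ≡⟨ cong (g ∘_) (⟨!,⟩∘ _ _) ⟩
    g ∘ ⟨ ! , f ∘ ⟨ ! , id ⟩ ⟩            ≡⟨ cong (λ z → g ∘ ⟨ ! , z ⟩) (sym (identityˡ _)) ⟩
    g ∘ ⟨ ! , id ∘ (f ∘ ⟨ ! , id ⟩) ⟩     ≡⟨ cong (g ∘_) (sym (⟨!,⟩∘ _ _)) ⟩
    g ∘ (⟨ ! , id ⟩ ∘ (f ∘ ⟨ ! , id ⟩))   ≡⟨ sym (assoc _ _ _) ⟩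
    (g ∘ ⟨ ! , id ⟩) ∘ (f ∘ ⟨ ! , id ⟩)   ∎

  ∘⟨!,id⟩-∘snd : ∀ {A B} (f : Hom A B) → (f ∘ snd {⊤}) ∘ ⟨ ! , id ⟩ ≡ f
  ∘⟨!,id⟩-∘snd f = trans (assoc _ _ _) (trans (cong (f ∘_) (snd-β _ _)) (identityʳ _))

  ∘snd-∘⟨!,id⟩ : ∀ {A B} (g : Hom (⊤ × A) B) → (g ∘ ⟨ ! , id ⟩) ∘ snd ≡ g
  ∘snd-∘⟨!,id⟩ g = begin
    (g ∘ ⟨ ! , id ⟩) ∘ snd     ≡⟨ assoc _ _ _ ⟩
    g ∘ (⟨ ! , id ⟩ ∘ snd)     ≡⟨ cong (g ∘_) (⟨!,⟩∘ _ _) ⟩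
    g ∘ ⟨ ! , id ∘ snd ⟩       ≡⟨ cong (λ z → g ∘ ⟨ z , id ∘ snd ⟩) (sym (!-unique fst)) ⟩
    g ∘ ⟨ fst , id ∘ snd ⟩     ≡⟨ cong (λ z → g ∘ ⟨ fst , z ⟩) (identityˡ _) ⟩
    g ∘ ⟨ fst , snd ⟩          ≡⟨ cong (g ∘_) ⟨fst,snd⟩ ⟩
    g ∘ id                     ≡⟨ identityʳ _ ⟩
    g                          ∎

  unit⁻¹ : CCCMor (UnaryCCC.ccc (ContextScwf.scwf C)) C
  unit⁻¹ = record
    { F₀ = λ A → A ; F₁ = λ g → g ∘ ⟨ ! , id ⟩
    ; F-id = snd-β _ _
    ; F-∘ = ∘⟨!,id⟩-∘₁
    ; F-⊤ = refl ; F-× = λ _ _ → refl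
    ; F-fst = λ _ _ → ∘⟨!,id⟩-∘snd fst
    ; F-snd = λ _ _ → ∘⟨!,id⟩-∘snd snd
    ; F-⇒ = λ _ _ → refl
    ; F-eval = λ A B → trans (cong (λ z → (eval ∘ z) ∘ ⟨ ! , id ⟩) (⟨fst∘,snd∘⟩ snd)) (∘⟨!,id⟩-∘snd eval)
    }

  unit⁻¹∘unit : (unit⁻¹ ∘ᶜ unit) ≈ᶜ idᶜ
  unit⁻¹∘unit = (λ _ → refl) , ∘⟨!,id⟩-∘snd

  unit∘unit⁻¹ : (unit ∘ᶜ unit⁻¹) ≈ᶜ idᶜ
  unit∘unit⁻¹ = (λ _ → refl) , ∘snd-∘⟨!,id⟩

unit-natural : ∀ {C D} (F : CCCMor C D) →
               (UnaryCCCMor.cccMor (ContextScwfMor.scwfMor F) ∘ᶜ Unit.unit C) ≈ᶜ (Unit.unit D ∘ᶜ F)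
unit-natural {C} {D} F = (λ _ → refl) , (λ {A} {B} f →
  ≋-to-≡ (subst-map-removable ⟦_⟧ (λ _ → F₀ B) (UnaryCCCMor.F-◇▹ F′ A) _ ∙
          subst₂-removable (F-⟦⟧ (A ∷ [])) refl _ ∙ F₁-∘ _ _ ∙ ∘-≋ ≋-refl (F₁-snd ∙ snd-≋ F-⊤ refl)))
  where
  open CCCMorProperties F
  open D
  open ContextScwf D using (⟦_⟧)
  open ContextScwfMor F using (F-⟦⟧) renaming (scwfMor to F′)

-- The counit

module Telescope (S : CScwf) where
  open ScwfProperties S
  open UnaryCCC S using (_∘₁_)

  ⟦_⟧ : List Ty → Ty
  ⟦_⟧ = ContextScwf.⟦_⟧ (UnaryCCC.ccc S)

  ctx : List Ty → Ctx
  ctx [] = ◇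
  ctx (A ∷ Γ) = ctx Γ ▹ A

  vars : ∀ Γ → Tm (ctx Γ) ⟦ Γ ⟧
  vars [] = 0₁
  vars (A ∷ Γ) = pair (vars Γ [ p ]) q

  unpack : ∀ Γ {Θ} → Tm Θ ⟦ Γ ⟧ → Sub Θ (ctx Γ)
  unpack [] t = !
  unpack (A ∷ Γ) t = ⟨ unpack Γ (fst t) , snd t ⟩

  pack : ∀ Γ → Sub (ctx Γ) (◇ ▹ ⟦ Γ ⟧)
  pack Γ = ⟨ ! , vars Γ ⟩

  unpack-∘ : ∀ Γ {Θ Θ'} (t : Tm Θ ⟦ Γ ⟧) (δ : Sub Θ' Θ) → unpack Γ t ∘ δ ≡ unpack Γ (t [ δ ])
  unpack-∘ [] t δ = !-unique _
  unpack-∘ (A ∷ Γ) t δ = trans (⟨⟩∘ _ _ δ) (cong₂ ⟨_,_⟩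
    (trans (unpack-∘ Γ (fst t) δ) (cong (unpack Γ) (fst-[] t δ))) (snd-[] t δ))

  vars[unpack] : ∀ Γ {Θ} (t : Tm Θ ⟦ Γ ⟧) → vars Γ [ unpack Γ t ] ≡ t
  vars[unpack] [] t = trans (N₁-η _) (sym (N₁-η t))
  vars[unpack] (A ∷ Γ) t = trans (pair-[] _ _ _) (trans (cong₂ pair
    (trans (sym ([∘] _ _ _)) (trans (cong (vars Γ [_]) (p∘⟨⟩ _ _)) (vars[unpack] Γ (fst t))))
    (q[⟨⟩] _ _)) (pair-η t))

  unpack-vars[] : ∀ Γ {Θ} (σ : Sub Θ (ctx Γ)) → unpack Γ (vars Γ [ σ ]) ≡ σ
  unpack-vars[] [] σ = sym (!-unique σ)
  unpack-vars[] (A ∷ Γ) σ = begin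
    ⟨ unpack Γ (fst (vars (A ∷ Γ) [ σ ])) , snd (vars (A ∷ Γ) [ σ ]) ⟩
      ≡⟨ cong₂ (λ u v → ⟨ unpack Γ (fst u) , snd v ⟩) (pair-[] _ _ _) (pair-[] _ _ _) ⟩
    ⟨ unpack Γ (fst (pair (vars Γ [ p ] [ σ ]) (q [ σ ]))) , snd (pair (vars Γ [ p ] [ σ ]) (q [ σ ])) ⟩
      ≡⟨ cong₂ (λ u v → ⟨ unpack Γ u , v ⟩) (fst-β _ _) (snd-β _ _) ⟩
    ⟨ unpack Γ (vars Γ [ p ] [ σ ]) , q [ σ ] ⟩
      ≡⟨ cong (λ u → ⟨ unpack Γ u , q [ σ ] ⟩) (sym ([∘] _ _ _)) ⟩
    ⟨ unpack Γ (vars Γ [ p ∘ σ ]) , q [ σ ] ⟩   ≡⟨ cong ⟨_, q [ σ ] ⟩ (unpack-vars[] Γ (p ∘ σ)) ⟩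
    ⟨ p ∘ σ , q [ σ ] ⟩                         ≡⟨ ⟨p∘,q[]⟩ σ ⟩
    σ                                           ∎

  unpack-vars : ∀ Γ → unpack Γ (vars Γ) ≡ id
  unpack-vars Γ = trans (cong (unpack Γ) (sym ([id] _))) (unpack-vars[] Γ id)

  pack∘unpack : ∀ Γ {Θ} (t : Tm Θ ⟦ Γ ⟧) → pack Γ ∘ unpack Γ t ≡ ⟨ ! , t ⟩
  pack∘unpack Γ t = trans (⟨!,⟩∘ _ _) (cong ⟨ ! ,_⟩ (vars[unpack] Γ t))

  unpack-q∘pack : ∀ Γ → unpack Γ q ∘ pack Γ ≡ id
  unpack-q∘pack Γ = trans (unpack-∘ Γ q (pack Γ)) (trans (cong (unpack Γ) (q[⟨⟩] _ _)) (unpack-vars Γ))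

  unpack-q∘⟨!,⟩ : ∀ Γ {Θ} (σ : Sub Θ (ctx Γ)) → unpack Γ q ∘ ⟨ ! , vars Γ [ σ ] ⟩ ≡ σ
  unpack-q∘⟨!,⟩ Γ σ = trans (unpack-∘ Γ q _) (trans (cong (unpack Γ) (q[⟨⟩] _ _)) (unpack-vars[] Γ σ))

  ∘₁[pack] : ∀ Δ Γ {B} (g : Tm (◇ ▹ ⟦ Γ ⟧) B) (f : Tm (◇ ▹ ⟦ Δ ⟧) ⟦ Γ ⟧) →
             (g ∘₁ f) [ pack Δ ] ≡ g [ pack Γ ] [ unpack Γ (f [ pack Δ ]) ]
  ∘₁[pack] Δ Γ g f = trans ([⟨!,⟩][] g f (pack Δ))
    (sym (trans (sym ([∘] _ _ _)) (cong (g [_]) (pack∘unpack Γ (f [ pack Δ ])))))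

  [pack][unpack-q] : ∀ Γ {A} (a : Tm (◇ ▹ ⟦ Γ ⟧) A) → a [ pack Γ ] [ unpack Γ q ] ≡ a
  [pack][unpack-q] Γ a = trans (sym ([∘] _ _ _)) (trans (cong (a [_]) (pack∘unpack Γ q)) ([⟨!,q⟩] a))

  counit : ScwfMor (ContextScwf.scwf (UnaryCCC.ccc S)) S
  counit = record
    { F₀ = ctx
    ; F₁ = λ {Δ} {Γ} f → unpack Γ (f [ pack Δ ])
    ; F-id = λ {Γ} → trans (cong (unpack Γ) (q[⟨⟩] _ _)) (unpack-vars Γ)
    ; F-∘ = λ {Γ} {Δ} {Θ} g f → trans (cong (unpack Θ) (∘₁[pack] Γ Δ g f)) (sym (unpack-∘ Θ _ _))
    ; F-◇ = refl
    ; FTy = λ A → A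
    ; FTm = λ {Γ} a → a [ pack Γ ]
    ; FTm-[] = λ {Γ} {Δ} a γ → ∘₁[pack] Δ Γ a γ
    ; F-▹ = λ _ _ → refl
    ; F-p = λ Γ A → trans (cong (unpack Γ) (fst-q[⟨!,pair⟩] _ _)) (unpack-vars[] Γ p)
    ; F-q = λ Γ A → snd-q[⟨!,pair⟩] _ _
    ; F-N₁ = refl
    ; F-0₁ = λ Γ → N₁-η _
    ; F-×ᵗ = λ _ _ → refl
    ; F-fst = λ c → trans ([⟨!,⟩][] _ _ _) (fst-q[⟨!,⟩] _)
    ; F-snd = λ c → trans ([⟨!,⟩][] _ _ _) (snd-q[⟨!,⟩] _)
    ; F-⇒ᵗ = λ _ _ → refl
    ; F-ap = λ c a → trans ([⟨!,⟩][] _ _ _)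
        (trans (cong (λ z → ap (fst q) (snd q) [ ⟨ ! , z ⟩ ]) (pair-[] _ _ _)) (ap-fst-snd[⟨!,pair⟩] _ _))
    }

  encodeSub : ∀ Δ Γ → Sub (ctx Δ) (ctx Γ) → Tm (◇ ▹ ⟦ Δ ⟧) ⟦ Γ ⟧
  encodeSub Δ Γ σ = vars Γ [ σ ∘ unpack Δ q ]

  encodeTm : ∀ Γ {A} → Tm (ctx Γ) A → Tm (◇ ▹ ⟦ Γ ⟧) A
  encodeTm Γ a = a [ unpack Γ q ]

  encodeSub-id : ∀ {Γ} → encodeSub Γ Γ id ≡ q
  encodeSub-id {Γ} = trans (cong (vars Γ [_]) (identityˡ _)) (vars[unpack] Γ q)

  encodeSub-∘ : ∀ {Γ Δ Θ} (σ : Sub (ctx Δ) (ctx Θ)) (τ : Sub (ctx Γ) (ctx Δ)) →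
                encodeSub Γ Θ (σ ∘ τ) ≡ encodeSub Δ Θ σ ∘₁ encodeSub Γ Δ τ
  encodeSub-∘ {Γ} {Δ} {Θ} σ τ = begin
    vars Θ [ (σ ∘ τ) ∘ unpack Γ q ]                              ≡⟨ cong (vars Θ [_]) (assoc _ _ _) ⟩
    vars Θ [ σ ∘ (τ ∘ unpack Γ q) ]
      ≡⟨ cong (λ z → vars Θ [ σ ∘ z ]) (sym (unpack-q∘⟨!,⟩ Δ (τ ∘ unpack Γ q))) ⟩
    vars Θ [ σ ∘ (unpack Δ q ∘ ⟨ ! , encodeSub Γ Δ τ ⟩) ]             ≡⟨ cong (vars Θ [_]) (sym (assoc _ _ _)) ⟩
    vars Θ [ (σ ∘ unpack Δ q) ∘ ⟨ ! , encodeSub Γ Δ τ ⟩ ]             ≡⟨ [∘] _ _ _ ⟩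
    encodeSub Δ Θ σ ∘₁ encodeSub Γ Δ τ                                   ∎

  encodeTm-[] : ∀ {Γ Δ A} (a : Tm (ctx Γ) A) (σ : Sub (ctx Δ) (ctx Γ)) →
                encodeTm Δ (a [ σ ]) ≡ encodeTm Γ a ∘₁ encodeSub Δ Γ σ
  encodeTm-[] {Γ} {Δ} a σ = begin
    a [ σ ] [ unpack Δ q ]                            ≡⟨ sym ([∘] _ _ _) ⟩
    a [ σ ∘ unpack Δ q ]                              ≡⟨ cong (a [_]) (sym (unpack-q∘⟨!,⟩ Γ (σ ∘ unpack Δ q))) ⟩
    a [ unpack Γ q ∘ ⟨ ! , encodeSub Δ Γ σ ⟩ ]             ≡⟨ [∘] _ _ _ ⟩
    encodeTm Γ a ∘₁ encodeSub Δ Γ σ                         ∎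

  encodeSub-p : ∀ {Γ A} → encodeSub (A ∷ Γ) Γ p ≡ fst q
  encodeSub-p {Γ} {A} = trans (cong (vars Γ [_]) (p∘⟨⟩ _ _)) (vars[unpack] Γ (fst q))

  encodeTm-q : ∀ {Γ A} → encodeTm (A ∷ Γ) q ≡ snd q
  encodeTm-q = q[⟨⟩] _ _

  encodeTm-fst : ∀ {Γ A B} (c : Tm (ctx Γ) (A ×ᵗ B)) → encodeTm Γ (fst c) ≡ fst q ∘₁ encodeTm Γ c
  encodeTm-fst c = trans (fst-[] _ _) (sym (fst-q[⟨!,⟩] _))

  encodeTm-snd : ∀ {Γ A B} (c : Tm (ctx Γ) (A ×ᵗ B)) → encodeTm Γ (snd c) ≡ snd q ∘₁ encodeTm Γ c
  encodeTm-snd c = trans (snd-[] _ _) (sym (snd-q[⟨!,⟩] _))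

  encodeTm-ap : ∀ {Γ A B} (c : Tm (ctx Γ) (A ⇒ᵗ B)) (a : Tm (ctx Γ) A) →
                encodeTm Γ (ap c a) ≡ ap (fst q) (snd q) ∘₁ pair (encodeTm Γ c) (encodeTm Γ a)
  encodeTm-ap c a = trans (ap-[] _ _ _) (sym (ap-fst-snd[⟨!,pair⟩] _ _))

  encodeSub-counit : ∀ Δ Γ (f : Tm (◇ ▹ ⟦ Δ ⟧) ⟦ Γ ⟧) → encodeSub Δ Γ (unpack Γ (f [ pack Δ ])) ≡ f
  encodeSub-counit Δ Γ f = begin
    vars Γ [ unpack Γ (f [ pack Δ ]) ∘ unpack Δ q ]   ≡⟨ cong (vars Γ [_]) (unpack-∘ Γ _ _) ⟩
    vars Γ [ unpack Γ (f [ pack Δ ] [ unpack Δ q ]) ] ≡⟨ vars[unpack] Γ _ ⟩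
    f [ pack Δ ] [ unpack Δ q ]                       ≡⟨ [pack][unpack-q] Δ f ⟩
    f                                                 ∎

  unpack-encodeSub[pack] : ∀ Δ Γ (σ : Sub (ctx Δ) (ctx Γ)) → unpack Γ (encodeSub Δ Γ σ [ pack Δ ]) ≡ σ
  unpack-encodeSub[pack] Δ Γ σ = begin
    unpack Γ (vars Γ [ σ ∘ unpack Δ q ] [ pack Δ ])   ≡⟨ cong (unpack Γ) (sym ([∘] _ _ _)) ⟩
    unpack Γ (vars Γ [ (σ ∘ unpack Δ q) ∘ pack Δ ])   ≡⟨ cong (λ z → unpack Γ (vars Γ [ z ])) σ∘id ⟩
    unpack Γ (vars Γ [ σ ])                           ≡⟨ unpack-vars[] Γ σ ⟩
    σ                                                 ∎
    where
    σ∘id : (σ ∘ unpack Δ q) ∘ pack Δ ≡ σ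
    σ∘id = trans (assoc _ _ _) (trans (cong (σ ∘_) (unpack-q∘pack Δ)) (identityʳ σ))

  encodeTm[pack] : ∀ Γ {A} (a : Tm (ctx Γ) A) → encodeTm Γ a [ pack Γ ] ≡ a
  encodeTm[pack] Γ a = trans (sym ([∘] _ _ _)) (trans (cong (a [_]) (unpack-q∘pack Γ)) ([id] a))

module Contextual (S : CScwf) where
  open ScwfProperties S
  open Telescope S

  typesOfLength : (n : ℕ) (Γ : Ctx) → len Γ ≡ n → List Ty
  typesOfLength zero Γ e = []
  typesOfLength (suc n) Γ e with len-suc e
  ... | Δ , A , _ , eΔ = A ∷ typesOfLength n Δ eΔ

  types : Ctx → List Ty
  types Γ = typesOfLength (len Γ) Γ refl

  ctx-typesOfLength : ∀ n Γ (e : len Γ ≡ n) → ctx (typesOfLength n Γ e) ≡ Γ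
  ctx-typesOfLength zero Γ e = sym (len-zero e)
  ctx-typesOfLength (suc n) Γ e with len-suc e
  ... | Δ , A , Γ≡Δ▹A , eΔ = trans (cong (_▹ A) (ctx-typesOfLength n Δ eΔ)) (sym Γ≡Δ▹A)

  ctx-types : ∀ Γ → ctx (types Γ) ≡ Γ
  ctx-types Γ = ctx-typesOfLength (len Γ) Γ refl

  typesOfLength-cong : ∀ {Γ Γ'} → Γ ≡ Γ' → ∀ n m (e : len Γ ≡ n) (e' : len Γ' ≡ m) →
                       typesOfLength n Γ e ≡ typesOfLength m Γ' e'
  typesOfLength-cong refl _ _ refl refl = refl

  types-▹ : ∀ Γ A → types (Γ ▹ A) ≡ A ∷ types Γ
  types-▹ Γ A = go (len (Γ ▹ A)) refl
    where
    go : ∀ n (e : len (Γ ▹ A) ≡ n) → typesOfLength n (Γ ▹ A) e ≡ A ∷ types Γ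
    go zero e = ⊥-elim (1+n≢0 (trans (sym (len-▹ Γ A)) e))
    go (suc n) e with len-suc e
    ... | Δ , A' , Γ▹A≡Δ▹A' , eΔ = cong₂ _∷_ (sym (▹-inj-ty Γ▹A≡Δ▹A'))
      (typesOfLength-cong (sym (▹-inj-ctx Γ▹A≡Δ▹A')) _ _ _ _)

  types-◇ : types ◇ ≡ []
  types-◇ = go (len ◇) refl
    where
    go : ∀ n (e : len ◇ ≡ n) → typesOfLength n ◇ e ≡ []
    go zero e = refl
    go (suc n) e = ⊥-elim (1+n≢0 (trans (sym e) len-◇))

  types-ctx : ∀ Γ → types (ctx Γ) ≡ Γ
  types-ctx [] = types-◇
  types-ctx (A ∷ Γ) = trans (types-▹ (ctx Γ) A) (cong (A ∷_) (types-ctx Γ))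

  toTelescope : ∀ {Δ Γ} → Sub Δ Γ → Sub (ctx (types Δ)) (ctx (types Γ))
  toTelescope {Δ} {Γ} = subst₂ Sub (sym (ctx-types Δ)) (sym (ctx-types Γ))

  toTelescopeᵗ : ∀ {Γ A} → Tm Γ A → Tm (ctx (types Γ)) A
  toTelescopeᵗ {Γ} {A} = subst (λ X → Tm X A) (sym (ctx-types Γ))

  toTelescope-≋ : ∀ {Δ Γ} (γ : Sub Δ Γ) → toTelescope γ ≋ˢ γ
  toTelescope-≋ = Subs.subst₂-removable _ _

  toTelescopeᵗ-≋ : ∀ {Γ A} (a : Tm Γ A) → toTelescopeᵗ a ≋ᵗ a
  toTelescopeᵗ-≋ = Tms.substˡ-removable _

  encodeSub-≋ : ∀ {Δ Γ Δ' Γ'} {σ : Sub (ctx Δ) (ctx Γ)} {σ' : Sub (ctx Δ') (ctx Γ')} →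
                Δ ≡ Δ' → Γ ≡ Γ' → σ ≋ˢ σ' → encodeSub Δ Γ σ ≋ᵗ encodeSub Δ' Γ' σ'
  encodeSub-≋ refl refl Subs.≋-refl = Tms.≋-refl

  encodeTm-≋ : ∀ {Γ Γ' A} {a : Tm (ctx Γ) A} {a' : Tm (ctx Γ') A} →
               Γ ≡ Γ' → a ≋ᵗ a' → encodeTm Γ a ≋ᵗ encodeTm Γ' a'
  encodeTm-≋ refl Tms.≋-refl = Tms.≋-refl

  toTelescope-id : ∀ {Γ} → toTelescope (id {Γ}) ≡ id
  toTelescope-id {Γ} = Subs.≋-to-≡ (toTelescope-≋ id Subs.∙ id-≋ (sym (ctx-types Γ)))

  toTelescope-∘ : ∀ {Γ Δ Θ} (g : Sub Δ Θ) (f : Sub Γ Δ) →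
                  toTelescope (g ∘ f) ≡ toTelescope g ∘ toTelescope f
  toTelescope-∘ g f = Subs.≋-to-≡ (toTelescope-≋ _ Subs.∙
    ∘-≋ (Subs.≋-sym (toTelescope-≋ g)) (Subs.≋-sym (toTelescope-≋ f)))

  toTelescopeᵗ-[] : ∀ {Γ Δ A} (a : Tm Γ A) (γ : Sub Δ Γ) →
                    toTelescopeᵗ (a [ γ ]) ≡ toTelescopeᵗ a [ toTelescope γ ]
  toTelescopeᵗ-[] a γ = Tms.≋-to-≡ (toTelescopeᵗ-≋ _ Tms.∙
    []-≋ (Tms.≋-sym (toTelescopeᵗ-≋ a)) (Subs.≋-sym (toTelescope-≋ γ)))

  toTelescopeᵗ-fst : ∀ {Γ A B} (c : Tm Γ (A ×ᵗ B)) → toTelescopeᵗ (fst c) ≡ fst (toTelescopeᵗ c)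
  toTelescopeᵗ-fst c = Tms.≋-to-≡ (toTelescopeᵗ-≋ _ Tms.∙ fst-≋ refl refl (Tms.≋-sym (toTelescopeᵗ-≋ c)))

  toTelescopeᵗ-snd : ∀ {Γ A B} (c : Tm Γ (A ×ᵗ B)) → toTelescopeᵗ (snd c) ≡ snd (toTelescopeᵗ c)
  toTelescopeᵗ-snd c = Tms.≋-to-≡ (toTelescopeᵗ-≋ _ Tms.∙ snd-≋ refl refl (Tms.≋-sym (toTelescopeᵗ-≋ c)))

  toTelescopeᵗ-ap : ∀ {Γ A B} (c : Tm Γ (A ⇒ᵗ B)) (a : Tm Γ A) →
                    toTelescopeᵗ (ap c a) ≡ ap (toTelescopeᵗ c) (toTelescopeᵗ a)
  toTelescopeᵗ-ap c a = Tms.≋-to-≡ (toTelescopeᵗ-≋ _ Tms.∙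
    ap-≋ refl (Tms.≋-sym (toTelescopeᵗ-≋ c)) (Tms.≋-sym (toTelescopeᵗ-≋ a)))

  counit⁻¹ : ScwfMor S (ContextScwf.scwf (UnaryCCC.ccc S))
  counit⁻¹ = record
    { F₀ = types
    ; F₁ = λ {Δ} {Γ} γ → encodeSub (types Δ) (types Γ) (toTelescope γ)
    ; F-id = λ {Γ} → trans (cong (encodeSub (types Γ) (types Γ)) toTelescope-id) (encodeSub-id {types Γ})
    ; F-∘ = λ {Γ} {Δ} {Θ} g f → trans (cong (encodeSub (types Γ) (types Θ)) (toTelescope-∘ g f))
              (encodeSub-∘ {types Γ} {types Δ} {types Θ} _ _)
    ; F-◇ = types-◇
    ; FTy = λ A → A
    ; FTm = λ {Γ} a → encodeTm (types Γ) (toTelescopeᵗ a)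
    ; FTm-[] = λ {Γ} {Δ} a γ → trans (cong (encodeTm (types Δ)) (toTelescopeᵗ-[] a γ))
              (encodeTm-[] {types Γ} {types Δ} _ _)
    ; F-▹ = types-▹
    ; F-p = λ Γ A → ≋-to-≡ (subst-map-removable (λ X → ◇ ▹ ⟦ X ⟧) (λ _ → ⟦ types Γ ⟧) (types-▹ Γ A) _ ∙
              encodeSub-≋ (types-▹ Γ A) (refl {x = types Γ})
                (toTelescope-≋ p Subs.∙ p-≋ (sym (ctx-types Γ)) refl) ∙
              ≡-to-≋ (encodeSub-p {types Γ}))
    ; F-q = λ Γ A → ≋-to-≡ (subst-map-removable (λ X → ◇ ▹ ⟦ X ⟧) (λ _ → A) (types-▹ Γ A) _ ∙
              encodeTm-≋ (types-▹ Γ A) (toTelescopeᵗ-≋ q ∙ q-≋ (sym (ctx-types Γ)) refl) ∙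
              ≡-to-≋ (encodeTm-q {types Γ}))
    ; F-N₁ = refl
    ; F-0₁ = λ Γ → N₁-η _
    ; F-×ᵗ = λ _ _ → refl
    ; F-fst = λ {Γ} c → trans (cong (encodeTm (types Γ)) (toTelescopeᵗ-fst c)) (encodeTm-fst {types Γ} _)
    ; F-snd = λ {Γ} c → trans (cong (encodeTm (types Γ)) (toTelescopeᵗ-snd c)) (encodeTm-snd {types Γ} _)
    ; F-⇒ᵗ = λ _ _ → refl
    ; F-ap = λ {Γ} c a → trans (cong (encodeTm (types Γ)) (toTelescopeᵗ-ap c a)) (encodeTm-ap {types Γ} _ _)
    }
    where open Tms using (_∙_; ≡-to-≋; ≋-to-≡; subst-map-removable)

  counit⁻¹∘counit : (counit⁻¹ ∘ˢ counit) ≈ˢ idˢ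
  counit⁻¹∘counit =
      types-ctx
    , (λ {Δ} {Γ} f → ≋-to-≡ (subst₂-map-removable (λ X → ◇ ▹ ⟦ X ⟧) ⟦_⟧ (types-ctx Δ) (types-ctx Γ) _ ∙
          encodeSub-≋ (types-ctx Δ) (types-ctx Γ) (toTelescope-≋ _) ∙ ≡-to-≋ (encodeSub-counit Δ Γ f)))
    , (λ _ → refl)
    , (λ {Γ} a → ≋-to-≡ (subst₂-map-removable (λ X → ◇ ▹ ⟦ X ⟧) (λ X → X) (types-ctx Γ) refl _ ∙
          encodeTm-≋ (types-ctx Γ) (toTelescopeᵗ-≋ _) ∙ ≡-to-≋ ([pack][unpack-q] Γ a)))
    where open Tms using (_∙_; ≡-to-≋; ≋-to-≡; subst₂-map-removable)

  counit∘counit⁻¹ : (counit ∘ˢ counit⁻¹) ≈ˢ idˢ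
  counit∘counit⁻¹ =
      ctx-types
    , (λ {Δ} {Γ} γ → Subs.≋-to-≡ (Subs.subst₂-removable _ _ _ Subs.∙
          Subs.≡-to-≋ (unpack-encodeSub[pack] (types Δ) (types Γ) _) Subs.∙ toTelescope-≋ γ))
    , (λ _ → refl)
    , (λ {Γ} a → Tms.≋-to-≡ (Tms.subst₂-removable _ _ _ Tms.∙
          Tms.≡-to-≋ (encodeTm[pack] (types Γ) _) Tms.∙ toTelescopeᵗ-≋ a))

module TelescopeMor {S T : CScwf} (F : ScwfMor S T) where
  private
    module S = ScwfProperties S
    module S′ = Telescope S
    module T′ = Telescope T
  open ScwfMorProperties F
  open T using (_≋ˢ_; _≋ᵗ_)
  open T.Subs using () renaming (_∙_ to _∙ˢ_)
  open T.Tms using (_∙_; ≋-sym; ≋-to-≡)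
  open UnaryCCCMor F using (cccMor; onHom-≋)
  open ContextScwfMor cccMor using (F-⟦⟧) renaming (scwfMor to roundTrip)

  F-ctx : ∀ Γ → F₀ (S′.ctx Γ) ≡ T′.ctx (map FTy Γ)
  F-ctx [] = F-◇
  F-ctx (A ∷ Γ) = trans (F-▹ (S′.ctx Γ) A) (cong (T._▹ FTy A) (F-ctx Γ))

  F-vars : ∀ Γ → FTm (S′.vars Γ) ≋ᵗ T′.vars (map FTy Γ)
  F-vars [] = FTm-0₁ ∙ T.0₁-≋ F-◇
  F-vars (A ∷ Γ) = FTm-pair _ _ ∙ T.pair-≋ (FTm-[]≋ _ _ ∙ T.[]-≋ (F-vars Γ) (F₁-p ∙ˢ T.p-≋ (F-ctx Γ) refl))
                                           (FTm-q ∙ T.q-≋ (F-ctx Γ) refl)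

  F-unpack : ∀ Γ {Θ} (t : S.Tm Θ S′.⟦ Γ ⟧) {Θ'} (t' : T.Tm Θ' T′.⟦ map FTy Γ ⟧) →
             F₀ Θ ≡ Θ' → FTm t ≋ᵗ t' → F₁ (S′.unpack Γ t) ≋ˢ T′.unpack (map FTy Γ) t'
  F-unpack [] t t' eΘ e = T.!-≋ F-◇ eΘ _
  F-unpack (A ∷ Γ) t t' eΘ e = F₁-⟨⟩ _ _ ∙ˢ T.⟨⟩-≋
    (F-unpack Γ (S.fst t) (T.fst t') eΘ (FTm-fst t (F-⟦⟧ Γ) refl e))
    (FTm-snd t (F-⟦⟧ Γ) refl e)

  F-pack : ∀ Γ → F₁ (S′.pack Γ) ≋ˢ T′.pack (map FTy Γ)
  F-pack Γ = F₁-⟨⟩ _ _ ∙ˢ T.⟨⟩-≋ (T.!-≋ F-◇ (F-ctx Γ) _) (F-vars Γ)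

  counit-natural : (F ∘ˢ S′.counit) ≈ˢ (T′.counit ∘ˢ roundTrip)
  counit-natural =
      F-ctx
    , (λ {Δ} {Γ} f → T.Subs.≋-to-≡ (T.Subs.subst₂-removable _ _ _ ∙ˢ
        F-unpack Γ (f S.[ S′.pack Δ ]) (ScwfMor.F₁ roundTrip {Δ} {Γ} f T.[ T′.pack (map FTy Δ) ]) (F-ctx Δ)
          (FTm-[]≋ f _ ∙ T.[]-≋ (≋-sym (retyped (F-⟦⟧ Δ) (F-⟦⟧ Γ) f)) (F-pack Δ))))
    , (λ _ → refl)
    , (λ {Γ} a → ≋-to-≡ (T.Tms.subst₂-removable _ _ _ ∙ FTm-[]≋ a _ ∙
        T.[]-≋ (≋-sym (retyped (F-⟦⟧ Γ) refl a)) (F-pack Γ)))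
    where
    retyped : ∀ {A A' B B'} (e : FTy A ≡ A') (e' : FTy B ≡ B') (f : S.Tm (S.◇ S.▹ A) B) →
              subst₂ (λ X Y → T.Tm (T.◇ T.▹ X) Y) e e' (UnaryCCCMor.onHom F f) ≋ᵗ FTm f
    retyped e e' f = T.Tms.subst₂-map-removable (T.◇ T.▹_) (λ X → X) e e' _ ∙ onHom-≋ f

theorem4 : Equivalence CCCs Scwfs-N₁×⇒-ctx
theorem4 = record
  { F = CCCs⇒Scwfs
  ; G = Scwfs⇒CCCs
  ; η = Unit.unit
  ; η⁻¹ = Unit.unit⁻¹
  ; η-isoˡ = Unit.unit⁻¹∘unit
  ; η-isoʳ = Unit.unit∘unit⁻¹
  ; η-natural = unit-natural
  ; ε = Telescope.counit
  ; ε⁻¹ = Contextual.counit⁻¹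
  ; ε-isoˡ = Contextual.counit⁻¹∘counit
  ; ε-isoʳ = Contextual.counit∘counit⁻¹
  ; ε-natural = TelescopeMor.counit-natural
  }
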